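{- Let $n\ge1$. Let $\mathcal A$ be the set of partitions $\lambda$ in which every part occurs at most twice, whose alternating sum type (modulus $3$) satisfies $\Sigma_2(\lambda)=2$, and in which exactly two basic units $(\lambda_{3i-2},\lambda_{3i-1},\lambda_{3i})$ satisfy $\lambda_{3i-1}-\lambda_{3i}=1$ (all other basic units then satisfy $\lambda_{3i-1}=\lambda_{3i}$). Put $$F_n=\frac{z^{n+1}q^{3n^2+7n+4}}{(zq;q^3)_{n+1}(q^3;q^3)_{n+1}}.$$ Then $$\sum_{\substack{\lambda\in\mathcal A\\ \lambda\text{ has exactly }3n+3\text{ positive parts}}} z^{\Sigma_1(\lambda)}q^{|\lambda|}=F_n\Bigg[\sum_{k=1}^{n-1}\Big(\frac{1}{z^2q^{3k+1}}+\frac{1-q^{3k}}{zq^{3k}}\Big)+\frac{q^2}{z^2}+\frac{q^3(1-q^{3n})}{z}+\sum_{d=1}^{n-1}\Big(\sum_{k=1}^{n-d-1}\frac{1}{z^2q^{6k+3d+1}}+\frac{1}{z^2q^{3n-3d-2}}\Big)\Bigg],$$ where empty sums are zero.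
   Context: For a partition $\lambda_1\ge\dots\ge\lambda_r>0$, append zero parts so that its length becomes a multiple $3k$ of $3$. Its basic units are the blocks $(\lambda_{3i-2},\lambda_{3i-1},\lambda_{3i})$, $1\le i\le k$, and its alternating sum type (modulus 3) is $(\Sigma_1,\Sigma_2)$ with $\Sigma_1=\sum_{i=1}^k(\lambda_{3i-2}-\lambda_{3i-1})$ and $\Sigma_2=\sum_{i=1}^k(\lambda_{3i-1}-\lambda_{3i})$. $|\lambda|$ is the sum of the parts. $(a;q)_n=\prod_{i=0}^{n-1}(1-aq^i)$, with $(a;q)_0=1$. The identity is one of formal power series in $q$ with coefficients Laurent polynomials in $z$. -}

module Defs where

open import Data.Nat as ℕ using (ℕ; zero; suc; _≤_; _<_; _≥_; _≡ᵇ_)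
import Data.Nat.DivMod as DM
open import Data.Integer as ℤ using (ℤ; +_; -[1+_]; _-_)
open import Data.List using (List; []; _∷_; _++_; map; concatMap; upTo; foldr; length; filter)
open import Data.List.Relation.Unary.All using (All)
open import Data.List.Relation.Unary.Linked using (Linked)
open import Data.Product using (_×_; _,_)
open import Data.Bool using (Bool; true; false; if_then_else_; _∧_)
open import Relation.Binary.PropositionalEquality using (_≡_)

IsPartition : List ℕ → Set
IsPartition λ′ = Linked _≥_ λ′ × All (λ x → 0 < x) λ′

size : List ℕ → ℕ
size = foldr ℕ._+_ 0

AtMostTwice : List ℕ → Set
AtMostTwice λ′ = ∀ x → length (filter (ℕ._≟ x) λ′) ≤ 2

units : List ℕ → List (ℕ × ℕ × ℕ)
units []                 = []
units (a ∷ [])           = (a , 0 , 0) ∷ []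
units (a ∷ b ∷ [])       = (a , b , 0) ∷ []
units (a ∷ b ∷ c ∷ rest) = (a , b , c) ∷ units rest

sumℤ : List ℤ → ℤ
sumℤ = foldr ℤ._+_ (+ 0)

Σ₁ : List ℕ → ℤ
Σ₁ λ′ = sumℤ (map (λ { (a , b , c) → + a - + b }) (units λ′))

Σ₂ : List ℕ → ℤ
Σ₂ λ′ = sumℤ (map (λ { (a , b , c) → + b - + c }) (units λ′))

numUnitsDiff1 : List ℕ → ℕ
numUnitsDiff1 λ′ = length (filter (λ { (a , b , c) → b ℕ.≟ suc c }) (units λ′))

In𝒜 : List ℕ → Set
In𝒜 λ′ = IsPartition λ′ × AtMostTwice λ′ × Σ₂ λ′ ≡ + 2 × numUnitsDiff1 λ′ ≡ 2

-- Formal power series in z, q with nonnegative exponents: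
-- PS = coefficient of z^x q^y.

PS : Set
PS = ℕ → ℕ → ℤ

oneS : PS
oneS zero zero = + 1
oneS _    _    = + 0

_*S_ : PS → PS → PS
(f *S g) a b = sumℤ (concatMap (λ i → map (λ j → f i j ℤ.* g (a ℕ.∸ i) (b ℕ.∸ j)) (upTo (suc b))) (upTo (suc a)))

-- 1/(1 - z^a q^(suc b)) = Σ_{m ≥ 0} z^{m a} q^{m (suc b)}
geomInv : ℕ → ℕ → PS
geomInv a b x y =
  if ((y DM.% suc b) ≡ᵇ 0) ∧ (x ≡ᵇ ((y DM./ suc b) ℕ.* a)) then + 1 else + 0

-- 1 / ((z q; q^3)_m (q^3; q^3)_m)
-- = ∏_{i<m} 1/(1 - z q^{3i+1}) · 1/(1 - q^{3i+3})
pochInv : ℕ → PS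
pochInv zero    = oneS
pochInv (suc m) = (pochInv m *S geomInv 1 (3 ℕ.* m)) *S geomInv 0 (3 ℕ.* m ℕ.+ 2)

-- Laurent polynomials in z, q: lists of terms (coefficient, z-exponent, q-exponent).

LP : Set
LP = List (ℤ × ℤ × ℤ)

mono : ℤ → ℤ → ℤ → LP
mono c a b = (c , a , b) ∷ []

infixr 5 _⊕_
infixr 7 _⊗_

_⊕_ : LP → LP → LP
_⊕_ = _++_

_⊗_ : LP → LP → LP
p ⊗ r = concatMap (λ { (c , a , b) → map (λ { (d , a′ , b′) → (c ℤ.* d , a ℤ.+ a′ , b ℤ.+ b′) }) r }) p

-- Σ_{k=1}^{m} f k  (empty sum when m = 0)
ΣLP : ℕ → (ℕ → LP) → LP
ΣLP m f = concatMap f (map suc (upTo m))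

coefAt : PS → ℤ → ℤ → ℤ
coefAt f (+ x) (+ y) = f x y
coefAt f _     _     = + 0

coefLPS : LP → PS → ℤ → ℤ → ℤ
coefLPS p f i j = sumℤ (map (λ { (c , a , b) → c ℤ.* coefAt f (i - a) (j - b) }) p)

bracket : ℕ → LP
bracket n =
  ΣLP (n ℕ.∸ 1) (λ k →
      mono (+ 1) (ℤ.- + 2) (ℤ.- (+ (3 ℕ.* k ℕ.+ 1)))
    ⊕ (mono (+ 1) (ℤ.- + 1) (ℤ.- + (3 ℕ.* k)) ⊗ (mono (+ 1) (+ 0) (+ 0) ⊕ mono (ℤ.- + 1) (+ 0) (+ (3 ℕ.* k)))))
  ⊕ mono (+ 1) (ℤ.- + 2) (+ 2)
  ⊕ (mono (+ 1) (ℤ.- + 1) (+ 3) ⊗ (mono (+ 1) (+ 0) (+ 0) ⊕ mono (ℤ.- + 1) (+ 0) (+ (3 ℕ.* n))))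
  ⊕ ΣLP (n ℕ.∸ 1) (λ d →
        ΣLP (n ℕ.∸ d ℕ.∸ 1) (λ k →
          mono (+ 1) (ℤ.- + 2) (ℤ.- (+ (6 ℕ.* k ℕ.+ 3 ℕ.* d ℕ.+ 1))))
      ⊕ mono (+ 1) (ℤ.- + 2) (ℤ.- (+ (3 ℕ.* n) - + (3 ℕ.* d) - + 2)))

-- F_n · bracket = z^{n+1} q^{3n²+7n+4} · bracket / ((zq;q³)_{n+1} (q³;q³)_{n+1});
-- coefficient of z^i q^j
rhsCoef : ℕ → ℤ → ℤ → ℤ
rhsCoef n = coefLPS (mono (+ 1) (+ (suc n)) (+ (3 ℕ.* n ℕ.* n ℕ.+ 7 ℕ.* n ℕ.+ 4)) ⊗ bracket n) (pochInv (suc n))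

module Submission where

-- Read a partition with 3(n+1) parts through the differences (x , d , y) of its basic units.  Membership
-- in 𝒜 says that exactly two units have d = 1, all others d = 0, and that λ_i > λ_{i+2} throughout.  Such
-- a difference list is determined by its shape (how many units precede, separate and follow the two
-- special ones) together with the excess of every x and y over its least admissible value.  The
-- excesses are free: they are the monomials of 1 / ((zq; q³)_{n+1} (q³; q³)_{n+1}).  The least
-- partition of each shape gives one monomial of z^{n+1} q^{3n²+7n+4} times the bracket.  Only two
-- adjacent special units interact: they need y + x′ ≥ 1 between them, which splits into y ≥ 1, or
-- y = 0 and x′ ≥ 1; the second case forbids a positive excess of that y, whence the factors 1 − q^{3k}.

open import Defs
open import Data.Bool using (true; false; if_then_else_; _∧_; T)
open import Data.Bool.Properties using (T-≡)
open import Data.Empty using (⊥; ⊥-elim)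
open import Data.Integer using (ℤ; +_; -[1+_]; -_) renaming (_+_ to _+ℤ_; _-_ to _-ℤ_; _*_ to _*ℤ_)
import Data.Integer.Properties as ℤₚ
import Data.Integer.Tactic.RingSolver as ℤ-Solver
open import Data.List using (List; []; _∷_; _++_; _∷ʳ_; map; concatMap; upTo; length; filter; replicate; cartesianProduct; _∷ʳ′_; initLast)
import Data.List.Properties as Listₚ
open import Data.List.Membership.Propositional using (_∈_; find; lose)
open import Data.List.Membership.Propositional.Properties
open import Data.List.Membership.Propositional.Properties.WithK using (unique∧set⇒bag)
open import Data.List.Relation.Binary.BagAndSetEquality using (∼bag⇒↭)
open import Data.List.Relation.Binary.Permutation.Propositional.Properties using (↭-length)
open import Data.List.Relation.Unary.All using (All; []; _∷_)
import Data.List.Relation.Unary.All as All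
import Data.List.Relation.Unary.All.Properties as All
import Data.List.Relation.Unary.AllPairs as AllPairs
import Data.List.Relation.Unary.AllPairs.Properties as AllPairs
open import Data.List.Relation.Unary.Any using (here; there)
open import Data.List.Relation.Unary.Linked using (Linked; []; [-]; _∷_)
open import Data.List.Relation.Unary.Unique.Propositional using (Unique; []; _∷_)
import Data.List.Relation.Unary.Unique.Propositional.Properties as Unique
open import Data.Nat using (ℕ; zero; suc; pred; _+_; _*_; _∸_; _≤_; _<_; _≥_; z≤n; s≤s; _≡ᵇ_; _≟_)
open import Data.Nat.DivMod using (_/_; _%_; m*n/n≡m; m*n%n≡0; m≡m%n+[m/n]*n)
import Data.Nat.Properties as ℕₚ
open import Data.Nat.Tactic.RingSolver using (solve-∀)
open import Data.Product using (_×_; _,_; proj₁; proj₂; ∃; ∃₂)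
open import Data.Sum using (inj₁; inj₂)
open import Data.Unit using (⊤; tt)
open import Function using (_∘_; id)
open import Function.Bundles using (_⇔_; mk⇔; module Equivalence)
open import Relation.Binary.PropositionalEquality
open import Relation.Nullary using (¬_; Dec; yes; no)
open import Relation.Unary using (Decidable)

private variable
  A B K : Set

unique-map-on : {f : A → B} {xs : List A} →
  (∀ {x y} → x ∈ xs → y ∈ xs → f x ≡ f y → x ≡ y) → Unique xs → Unique (map f xs)
unique-map-on inj [] = []
unique-map-on inj (x∉ ∷ u) =
  All.map⁺ (All.tabulate λ y∈ fx≡fy → All.lookup x∉ y∈ (inj (here refl) (there y∈) fx≡fy))
  ∷ unique-map-on (λ p q → inj (there p) (there q)) u

unique-concatMap : (F : K → List A) {ks : List K} →
  (∀ k → Unique (F k)) → (∀ {k k′ a} → a ∈ F k → a ∈ F k′ → k ≡ k′) →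
  Unique ks → Unique (concatMap F ks)
unique-concatMap F uF key uks =
  Unique.concat⁺ (All.map⁺ (All.tabulate (λ {k} _ → uF k)))
    (AllPairs.map⁺ {f = F} (AllPairs.map (λ k≢k′ {_} (a∈ , a∈′) → k≢k′ (key a∈ a∈′)) uks))

length-unique-≡ : {xs ys : List A} → Unique xs → Unique ys →
  (∀ {x} → x ∈ xs ⇔ x ∈ ys) → length xs ≡ length ys
length-unique-≡ ux uy xs≈ys = ↭-length (∼bag⇒↭ (unique∧set⇒bag ux uy xs≈ys))

length-∷ʳ : ∀ (xs : List A) x → length (xs ∷ʳ x) ≡ suc (length xs)
length-∷ʳ xs x = trans (Listₚ.length-++ xs) (ℕₚ.+-comm (length xs) 1)

sumℤ-++ : ∀ (xs ys : List ℤ) → sumℤ (xs ++ ys) ≡ sumℤ xs +ℤ sumℤ ys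
sumℤ-++ []       ys = sym (ℤₚ.+-identityˡ _)
sumℤ-++ (x ∷ xs) ys = trans (cong (x +ℤ_) (sumℤ-++ xs ys)) (sym (ℤₚ.+-assoc x _ _))

sumℤ-concatMap : (g : K → List ℤ) (ks : List K) →
  sumℤ (concatMap g ks) ≡ sumℤ (map (sumℤ ∘ g) ks)
sumℤ-concatMap g []       = refl
sumℤ-concatMap g (k ∷ ks) = trans (sumℤ-++ (g k) _) (cong (sumℤ (g k) +ℤ_) (sumℤ-concatMap g ks))

length-concatMap : (F : K → List A) (ks : List K) →
  + length (concatMap F ks) ≡ sumℤ (map (λ k → + length (F k)) ks)
length-concatMap F []       = refl
length-concatMap F (k ∷ ks) =
  trans (cong +_ (Listₚ.length-++ (F k))) (cong (+ length (F k) +ℤ_) (length-concatMap F ks))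

length-cartesianProduct : (xs : List A) (ys : List B) →
  length (cartesianProduct xs ys) ≡ length xs * length ys
length-cartesianProduct []       ys = refl
length-cartesianProduct (x ∷ xs) ys =
  trans (Listₚ.length-++ (map (x ,_) ys))
        (cong₂ _+_ (Listₚ.length-map _ ys) (length-cartesianProduct xs ys))

_Counts_ : (ℕ → ℕ → List A) → PS → Set
F Counts f = ∀ a b → f a b ≡ + length (F a b)

Graded : (A → ℕ × ℕ) → (ℕ → ℕ → List A) → Set
Graded deg F = ∀ {a b u} → u ∈ F a b → deg u ≡ (a , b)

_+²_ : ℕ × ℕ → ℕ × ℕ → ℕ × ℕ
(a , b) +² (c , d) = (a + c , b + d)

-- Opaque, so that the families F and G can be recovered from (F ⊠ G) a b by unification.
opaque
  infixl 7 _⊠_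
  _⊠_ : (ℕ → ℕ → List A) → (ℕ → ℕ → List B) → ℕ → ℕ → List (A × B)
  (F ⊠ G) a b = concatMap (λ i → concatMap (λ j → cartesianProduct (F i j) (G (a ∸ i) (b ∸ j)))
                                            (upTo (suc b)))
                          (upTo (suc a))

  ⊠-counts : {A B : Set} {F : ℕ → ℕ → List A} {G : ℕ → ℕ → List B} {f g : PS} →
    F Counts f → G Counts g → (F ⊠ G) Counts (f *S g)
  ⊠-counts {A} {B} {F} {G} {f} {g} cF cG a b = begin
    (f *S g) a b
      ≡⟨ sumℤ-concatMap (λ i → map (λ j → f i j *ℤ g (a ∸ i) (b ∸ j)) js) is ⟩
    sumℤ (map (λ i → sumℤ (map (λ j → f i j *ℤ g (a ∸ i) (b ∸ j)) js)) is)
      ≡⟨ cong sumℤ (Listₚ.map-cong (λ i → cong sumℤ (Listₚ.map-cong (cell i) js)) is) ⟩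
    sumℤ (map (λ i → sumℤ (map (λ j → + length (block i j)) js)) is)
      ≡⟨ cong sumℤ (Listₚ.map-cong (λ i → sym (length-concatMap (block i) js)) is) ⟩
    sumℤ (map (λ i → + length (concatMap (block i) js)) is)
      ≡⟨ sym (length-concatMap (λ i → concatMap (block i) js) is) ⟩
    + length ((F ⊠ G) a b) ∎
    where
    open ≡-Reasoning
    is js : List ℕ
    is = upTo (suc a)
    js = upTo (suc b)
    block : ℕ → ℕ → List (A × B)
    block i j = cartesianProduct (F i j) (G (a ∸ i) (b ∸ j))
    cell : ∀ i j → f i j *ℤ g (a ∸ i) (b ∸ j) ≡ + length (block i j)
    cell i j = begin
      f i j *ℤ g (a ∸ i) (b ∸ j)                    ≡⟨ cong₂ _*ℤ_ (cF i j) (cG (a ∸ i) (b ∸ j)) ⟩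
      + length (F i j) *ℤ + length (G (a ∸ i) (b ∸ j)) ≡⟨ sym (ℤₚ.pos-* (length (F i j)) _) ⟩
      + (length (F i j) * length (G (a ∸ i) (b ∸ j)))  ≡⟨ cong +_ (sym (length-cartesianProduct (F i j) _)) ⟩
      + length (block i j)                              ∎

  ∈-⊠⁻ : {F : ℕ → ℕ → List A} {G : ℕ → ℕ → List B} {a b : ℕ} {u : A} {v : B} → (u , v) ∈ (F ⊠ G) a b →
    ∃₂ λ i j → i ≤ a × j ≤ b × u ∈ F i j × v ∈ G (a ∸ i) (b ∸ j)
  ∈-⊠⁻ {F = F} {G} {a} {b} uv∈
    with i , i∈ , uv∈ᵢ ← find (∈-concatMap⁻ _ {xs = upTo (suc a)} uv∈)
    with j , j∈ , uv∈ᵢⱼ ← find (∈-concatMap⁻ _ {xs = upTo (suc b)} uv∈ᵢ)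
    with u∈ , v∈ ← ∈-cartesianProduct⁻ (F i j) (G (a ∸ i) (b ∸ j)) uv∈ᵢⱼ =
    i , j , ℕₚ.≤-pred (∈-upTo⁻ i∈) , ℕₚ.≤-pred (∈-upTo⁻ j∈) , u∈ , v∈

  ∈-⊠⁺ : {F : ℕ → ℕ → List A} {G : ℕ → ℕ → List B} {a b i j : ℕ} {u : A} {v : B} →
    i ≤ a → j ≤ b → u ∈ F i j → v ∈ G (a ∸ i) (b ∸ j) → (u , v) ∈ (F ⊠ G) a b
  ∈-⊠⁺ i≤a j≤b u∈ v∈ =
    ∈-concatMap⁺ _ (lose (∈-upTo⁺ (s≤s i≤a))
      (∈-concatMap⁺ _ (lose (∈-upTo⁺ (s≤s j≤b)) (∈-cartesianProduct⁺ u∈ v∈))))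

  ⊠-unique : {F : ℕ → ℕ → List A} {G : ℕ → ℕ → List B} {deg : A → ℕ × ℕ} → Graded deg F →
    (∀ a b → Unique (F a b)) → (∀ a b → Unique (G a b)) → ∀ a b → Unique ((F ⊠ G) a b)
  ⊠-unique {F = F} {G} gF uF uG a b =
    unique-concatMap _
      (λ i → unique-concatMap _ (λ j → Unique.cartesianProduct⁺ (uF i j) (uG _ _))
        (λ p q → trans (sym (cong proj₂ (gF (cell p)))) (cong proj₂ (gF (cell q))))
        (Unique.upTo⁺ (suc b)))
      (λ p q → trans (sym (cong proj₁ (gF (proj₂ (row p))))) (cong proj₁ (gF (proj₂ (row q)))))
      (Unique.upTo⁺ (suc a))
    where
    cell : ∀ {i j u v} → (u , v) ∈ cartesianProduct (F i j) (G (a ∸ i) (b ∸ j)) → u ∈ F i j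
    cell {i} {j} uv∈ = proj₁ (∈-cartesianProduct⁻ (F i j) _ uv∈)
    row : ∀ {i u v} → (u , v) ∈ concatMap (λ j → cartesianProduct (F i j) (G (a ∸ i) (b ∸ j))) (upTo (suc b)) →
          ∃ λ j → u ∈ F i j
    row uv∈ with j , _ , uv∈ⱼ ← find (∈-concatMap⁻ _ {xs = upTo (suc b)} uv∈) = j , cell uv∈ⱼ

⊠-graded : {F : ℕ → ℕ → List A} {G : ℕ → ℕ → List B} {degF : A → ℕ × ℕ} {degG : B → ℕ × ℕ} →
  Graded degF F → Graded degG G → Graded (λ (u , v) → degF u +² degG v) (F ⊠ G)
⊠-graded gF gG uv∈ with i , j , i≤a , j≤b , u∈ , v∈ ← ∈-⊠⁻ uv∈
                    rewrite gF u∈ | gG v∈ =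
  cong₂ _,_ (ℕₚ.m+[n∸m]≡n i≤a) (ℕₚ.m+[n∸m]≡n j≤b)

∈-⊠⁺′ : {F : ℕ → ℕ → List A} {G : ℕ → ℕ → List B} {i j k l : ℕ} {u : A} {v : B} →
  u ∈ F i j → v ∈ G k l → (u , v) ∈ (F ⊠ G) (i + k) (j + l)
∈-⊠⁺′ {G = G} {i} {j} {k} {l} {v = v} u∈ v∈ =
  ∈-⊠⁺ (ℕₚ.m≤m+n i k) (ℕₚ.m≤m+n j l) u∈
    (subst₂ (λ k′ l′ → v ∈ G k′ l′) (sym (ℕₚ.m+n∸m≡n i k)) (sym (ℕₚ.m+n∸m≡n j l)) v∈)

geomTerms : ℕ → ℕ → ℕ → ℕ → List ℕ
geomTerms a c x y =
  if ((y % suc c) ≡ᵇ 0) ∧ (x ≡ᵇ (y / suc c) * a) then y / suc c ∷ [] else []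

geomTerms-counts : ∀ a c → geomTerms a c Counts geomInv a c
geomTerms-counts a c x y with ((y % suc c) ≡ᵇ 0) ∧ (x ≡ᵇ (y / suc c) * a)
... | true  = refl
... | false = refl

geomTerms-unique : ∀ a c x y → Unique (geomTerms a c x y)
geomTerms-unique a c x y with ((y % suc c) ≡ᵇ 0) ∧ (x ≡ᵇ (y / suc c) * a)
... | true  = All.[] ∷ []
... | false = []

geomTerms-graded : ∀ a c → Graded (λ k → k * a , k * suc c) (geomTerms a c)
geomTerms-graded a c {x} {y} k∈
  with (y % suc c) ≡ᵇ 0 in y%≡0 | x ≡ᵇ (y / suc c) * a in x≡
geomTerms-graded a c {x} {y} (here refl) | true | true =
  cong₂ _,_ (sym (ℕₚ.≡ᵇ⇒≡ x _ (T-true x≡)))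
    (sym (trans (m≡m%n+[m/n]*n y (suc c)) (cong (_+ (y / suc c) * suc c) (ℕₚ.≡ᵇ⇒≡ _ 0 (T-true y%≡0)))))
  where
  T-true : ∀ {b} → b ≡ true → T b
  T-true = Equivalence.from T-≡

∈-geomTerms : ∀ a c k → k ∈ geomTerms a c (k * a) (k * suc c)
∈-geomTerms a c k
  rewrite m*n%n≡0 k (suc c) ⦃ _ ⦄ | m*n/n≡m k (suc c) ⦃ _ ⦄
        | Equivalence.to T-≡ (ℕₚ.≡⇒≡ᵇ (k * a) (k * a) refl) = here refl

-- Excess lists: the monomials of 1 / ((zq; q³)ₘ (q³; q³)ₘ)

-- The pair (x , y) at position k stands for (z q^(3k+1))^x (q^(3k+3))^y.
Excess : Set
Excess = ℕ × ℕ

zDegree : List Excess → ℕ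
zDegree []            = 0
zDegree ((x , _) ∷ f) = x + zDegree f

qDegree : ℕ → List Excess → ℕ
qDegree k []            = 0
qDegree k ((x , y) ∷ f) = (3 * k + 1) * x + (3 * k + 3) * y + qDegree (suc k) f

degree : List Excess → ℕ × ℕ
degree f = zDegree f , qDegree 0 f

zDegree-∷ʳ : ∀ f x y → zDegree (f ∷ʳ (x , y)) ≡ zDegree f + x
zDegree-∷ʳ []            x y = ℕₚ.+-identityʳ x
zDegree-∷ʳ ((a , _) ∷ f) x y = trans (cong (_+_ a) (zDegree-∷ʳ f x y)) (sym (ℕₚ.+-assoc a _ x))

qDegree-∷ʳ : ∀ k f x y → qDegree k (f ∷ʳ (x , y)) ≡
  qDegree k f + ((3 * (k + length f) + 1) * x + (3 * (k + length f) + 3) * y)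
qDegree-∷ʳ k [] x y =
  trans (ℕₚ.+-identityʳ _) (cong (λ t → (3 * t + 1) * x + (3 * t + 3) * y) (sym (ℕₚ.+-identityʳ k)))
qDegree-∷ʳ k ((a , b) ∷ f) x y rewrite qDegree-∷ʳ (suc k) f x y | ℕₚ.+-suc k (length f) =
  sym (ℕₚ.+-assoc ((3 * k + 1) * a + (3 * k + 3) * b) (qDegree (suc k) f) _)

degree-∷ʳ : ∀ {m} g x y → length g ≡ m →
  degree (g ∷ʳ (x , y)) ≡ (degree g +² (x * 1 , x * suc (3 * m))) +² (y * 0 , y * suc (3 * m + 2))
degree-∷ʳ g x y refl rewrite zDegree-∷ʳ g x y | qDegree-∷ʳ 0 g x y =
  cong₂ _,_ (arithmetic-z (zDegree g) x y) (arithmetic-q (qDegree 0 g) (length g) x y)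
  where
  arithmetic-z : ∀ s x y → s + x ≡ s + x * 1 + y * 0
  arithmetic-z = solve-∀
  arithmetic-q : ∀ w m x y →
    w + ((3 * m + 1) * x + (3 * m + 3) * y) ≡ w + x * suc (3 * m) + y * suc (3 * m + 2)
  arithmetic-q = solve-∀

appendExcess : (List Excess × ℕ) × ℕ → List Excess
appendExcess ((f , x) , y) = f ∷ʳ (x , y)

excesses : ℕ → ℕ → ℕ → List (List Excess)
excesses zero    zero    zero    = [] ∷ []
excesses zero    zero    (suc _) = []
excesses zero    (suc _) _       = []
excesses (suc m) a b =
  map appendExcess ((excesses m ⊠ geomTerms 1 (3 * m) ⊠ geomTerms 0 (3 * m + 2)) a b)

excesses-counts : ∀ m → excesses m Counts pochInv m
excesses-counts zero    zero    zero    = refl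
excesses-counts zero    zero    (suc b) = refl
excesses-counts zero    (suc a) b       = refl
excesses-counts (suc m) a b =
  trans (⊠-counts {F = excesses m ⊠ geomTerms 1 (3 * m)} {G = geomTerms 0 (3 * m + 2)}
           (⊠-counts {F = excesses m} {G = geomTerms 1 (3 * m)} (excesses-counts m) (geomTerms-counts 1 (3 * m)))
           (geomTerms-counts 0 (3 * m + 2)) a b)
        (cong +_ (sym (Listₚ.length-map appendExcess ((excesses m ⊠ geomTerms 1 (3 * m) ⊠ geomTerms 0 (3 * m + 2)) a b))))

∈-excesses⁻ : ∀ m {a b f} → f ∈ excesses m a b → length f ≡ m × degree f ≡ (a , b)
∈-excesses⁻ zero {zero} {zero} (here refl) = refl , refl
∈-excesses⁻ (suc m) {a} {b} f∈
  with ((g , x) , y) , gxy∈ , refl ← ∈-map⁻ appendExcess f∈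
  with i , j , _ , _ , gx∈ , _ ← ∈-⊠⁻ gxy∈
  with _ , _ , _ , _ , g∈ , _ ← ∈-⊠⁻ gx∈
  with length-g , _ ← ∈-excesses⁻ m g∈ =
  trans (length-∷ʳ g (x , y)) (cong suc length-g) ,
  trans (degree-∷ʳ g x y length-g)
    (⊠-graded (⊠-graded (proj₂ ∘ ∈-excesses⁻ m) (geomTerms-graded 1 (3 * m)))
              (geomTerms-graded 0 (3 * m + 2)) gxy∈)

∈-excesses⁺ : ∀ m f → length f ≡ m → f ∈ excesses m (zDegree f) (qDegree 0 f)
∈-excesses⁺ zero [] refl = here refl
∈-excesses⁺ (suc m) f length-f with initLast f
... | g ∷ʳ′ (x , y) =
  subst (λ (a , b) → g ∷ʳ (x , y) ∈ excesses (suc m) a b) (sym (degree-∷ʳ g x y length-g))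
    (∈-map⁺ appendExcess
      (∈-⊠⁺′ {F = excesses m ⊠ geomTerms 1 (3 * m)} {G = geomTerms 0 (3 * m + 2)}
        (∈-⊠⁺′ {F = excesses m} {G = geomTerms 1 (3 * m)} (∈-excesses⁺ m g length-g) (∈-geomTerms 1 (3 * m) x))
        (∈-geomTerms 0 (3 * m + 2) y)))
  where
  length-g : length g ≡ m
  length-g = ℕₚ.suc-injective (trans (sym (length-∷ʳ g (x , y))) length-f)

excesses-unique : ∀ m a b → Unique (excesses m a b)
excesses-unique zero    zero    zero    = All.[] ∷ []
excesses-unique zero    zero    (suc b) = []
excesses-unique zero    (suc a) b       = []
excesses-unique (suc m) a b =
  Unique.map⁺ appendExcess-injective
    (⊠-unique (⊠-graded (proj₂ ∘ ∈-excesses⁻ m) (geomTerms-graded 1 (3 * m)))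
      (⊠-unique (proj₂ ∘ ∈-excesses⁻ m) (excesses-unique m) (geomTerms-unique 1 (3 * m)))
      (geomTerms-unique 0 (3 * m + 2)) a b)
  where
  appendExcess-injective : ∀ {c c′} → appendExcess c ≡ appendExcess c′ → c ≡ c′
  appendExcess-injective {(g , _) , _} {(g′ , _) , _} eq with refl , refl ← Listₚ.∷ʳ-injective g g′ eq = refl

excessesℤ : ℕ → ℤ → ℤ → List (List Excess)
excessesℤ m (+ a)    (+ b)    = excesses m a b
excessesℤ m (+ _)    -[1+ _ ] = []
excessesℤ m -[1+ _ ] _        = []

excessesℤ-counts : ∀ m u v → coefAt (pochInv m) u v ≡ + length (excessesℤ m u v)
excessesℤ-counts m (+ a)    (+ b)    = excesses-counts m a b
excessesℤ-counts m (+ a)    -[1+ b ] = refl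
excessesℤ-counts m -[1+ a ] (+ b)    = refl
excessesℤ-counts m -[1+ a ] -[1+ b ] = refl

excessesℤ-unique : ∀ m u v → Unique (excessesℤ m u v)
excessesℤ-unique m (+ a)    (+ b)    = excesses-unique m a b
excessesℤ-unique m (+ a)    -[1+ b ] = []
excessesℤ-unique m -[1+ a ] v        = []

∈-excessesℤ : ∀ m u v {f} → f ∈ excessesℤ m u v ⇔ (length f ≡ m × + zDegree f ≡ u × + qDegree 0 f ≡ v)
∈-excessesℤ m u v {f} = mk⇔ (sound u v) complete
  where
  sound : ∀ u v → f ∈ excessesℤ m u v → length f ≡ m × + zDegree f ≡ u × + qDegree 0 f ≡ v
  sound (+ a) (+ b) f∈ with length-f , refl ← ∈-excesses⁻ m f∈ = length-f , refl , refl
  complete : length f ≡ m × + zDegree f ≡ u × + qDegree 0 f ≡ v → f ∈ excessesℤ m u v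
  complete (length-f , refl , refl) = ∈-excesses⁺ m f length-f

yAt : ℕ → List Excess → ℕ
yAt _       []            = 0
yAt zero    ((_ , y) ∷ _) = y
yAt (suc α) (_ ∷ f)       = yAt α f

raiseY : ℕ → List Excess → List Excess
raiseY _       []            = []
raiseY zero    ((x , y) ∷ f) = (x , suc y) ∷ f
raiseY (suc α) (e ∷ f)       = e ∷ raiseY α f

length-raiseY : ∀ α f → length (raiseY α f) ≡ length f
length-raiseY α       []      = refl
length-raiseY zero    (e ∷ f) = refl
length-raiseY (suc α) (e ∷ f) = cong suc (length-raiseY α f)

zDegree-raiseY : ∀ α f → zDegree (raiseY α f) ≡ zDegree f
zDegree-raiseY α       []            = refl
zDegree-raiseY zero    (e ∷ f)       = refl
zDegree-raiseY (suc α) ((x , _) ∷ f) = cong (_+_ x) (zDegree-raiseY α f)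

qDegree-raiseY : ∀ α k f → α < length f → qDegree k (raiseY α f) ≡ qDegree k f + 3 * suc (k + α)
qDegree-raiseY zero k ((x , y) ∷ f) _ = arithmetic k x y (qDegree (suc k) f)
  where
  arithmetic : ∀ k x y w → (3 * k + 1) * x + (3 * k + 3) * suc y + w ≡ (3 * k + 1) * x + (3 * k + 3) * y + w + 3 * suc (k + 0)
  arithmetic = solve-∀
qDegree-raiseY (suc α) k ((x , y) ∷ f) (s≤s α<) rewrite qDegree-raiseY α (suc k) f α< | ℕₚ.+-suc k α =
  sym (ℕₚ.+-assoc ((3 * k + 1) * x + (3 * k + 3) * y) (qDegree (suc k) f) _)

yAt-raiseY : ∀ α f → α < length f → yAt α (raiseY α f) ≡ suc (yAt α f)
yAt-raiseY zero    (e ∷ f) _        = refl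
yAt-raiseY (suc α) (e ∷ f) (s≤s α<) = yAt-raiseY α f α<

raiseY-injective : ∀ α {f g} → raiseY α f ≡ raiseY α g → f ≡ g
raiseY-injective _       {[]}    {[]}    _    = refl
raiseY-injective zero    {_ ∷ _} {_ ∷ _} refl = refl
raiseY-injective (suc α) {_ ∷ _} {_ ∷ _} eq   =
  cong₂ _∷_ (Listₚ.∷-injectiveˡ eq) (raiseY-injective α (Listₚ.∷-injectiveʳ eq))
raiseY-injective zero    {[]}    {_ ∷ _} ()
raiseY-injective (suc _) {[]}    {_ ∷ _} ()
raiseY-injective zero    {_ ∷ _} {[]}    ()
raiseY-injective (suc _) {_ ∷ _} {[]}    ()

yAt≢0⇒raiseY : ∀ α f → yAt α f ≢ 0 → ∃ λ g → f ≡ raiseY α g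
yAt≢0⇒raiseY α       []                  y≢0 = ⊥-elim (y≢0 refl)
yAt≢0⇒raiseY zero    ((x , zero) ∷ f)    y≢0 = ⊥-elim (y≢0 refl)
yAt≢0⇒raiseY zero    ((x , suc y) ∷ f)   y≢0 = (x , y) ∷ f , refl
yAt≢0⇒raiseY (suc α) (e ∷ f)             y≢0 with g , refl ← yAt≢0⇒raiseY α f y≢0 = e ∷ g , refl

+[m+n]≡o⇒+m≡o-n : ∀ {a c v} → + (a + c) ≡ v → + a ≡ v -ℤ + c
+[m+n]≡o⇒+m≡o-n {a} {c} refl = trans (cancel (+ a) (+ c)) (cong (_-ℤ + c) (sym (ℤₚ.pos-+ a c)))
  where
  cancel : ∀ x y → x ≡ (x +ℤ y) -ℤ y
  cancel = ℤ-Solver.solve-∀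

+m≡o-n⇒+[m+n]≡o : ∀ {a c v} → + a ≡ v -ℤ + c → + (a + c) ≡ v
+m≡o-n⇒+[m+n]≡o {a} {c} {v} eq = trans (ℤₚ.pos-+ a c) (trans (cong (_+ℤ + c) eq) (cancel v (+ c)))
  where
  cancel : ∀ x y → (x -ℤ y) +ℤ y ≡ x
  cancel = ℤ-Solver.solve-∀

-- Raising the y-entry at position α is a bijection from the excess lists of q-degree v − 3(α+1)
-- onto those of q-degree v whose y-entry at α is nonzero: this is the factor 1 − q^(3(α+1)).
length-filter-yAt≡0 : ∀ {m α} u v → α < m →
  + length (filter (λ f → yAt α f ≟ 0) (excessesℤ m u v)) ≡
  + length (excessesℤ m u v) -ℤ + length (excessesℤ m u (v -ℤ + (3 * suc α)))
length-filter-yAt≡0 {m} {α} u v α<m = +[m+n]≡o⇒+m≡o-n (cong +_ (sym (begin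
  length E
    ≡⟨ length-unique-≡ (excessesℤ-unique m u v) split-unique split ⟩
  length (filter yAt≟0 E ++ map (raiseY α) E′)
    ≡⟨ Listₚ.length-++ (filter yAt≟0 E) ⟩
  length (filter yAt≟0 E) + length (map (raiseY α) E′)
    ≡⟨ cong (_+_ (length (filter yAt≟0 E))) (Listₚ.length-map (raiseY α) E′) ⟩
  length (filter yAt≟0 E) + length E′ ∎)))
  where
  open ≡-Reasoning
  yAt≟0 : ∀ f → Dec (yAt α f ≡ 0)
  yAt≟0 f = yAt α f ≟ 0
  c = 3 * suc α
  E E′ : List (List Excess)
  E  = excessesℤ m u v
  E′ = excessesℤ m u (v -ℤ + c)

  raised∈E : ∀ {g} → g ∈ E′ → raiseY α g ∈ E × yAt α (raiseY α g) ≢ 0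
  raised∈E {g} g∈ with length-g , zDegree-g , qDegree-g ← Equivalence.to (∈-excessesℤ m u (v -ℤ + c)) g∈ =
    Equivalence.from (∈-excessesℤ m u v)
      ( trans (length-raiseY α g) length-g
      , trans (cong +_ (zDegree-raiseY α g)) zDegree-g
      , trans (cong +_ (qDegree-raiseY α 0 g α<g)) (+m≡o-n⇒+[m+n]≡o qDegree-g))
    , λ y≡0 → ℕₚ.0≢1+n (trans (sym y≡0) (yAt-raiseY α g α<g))
    where
    α<g : α < length g
    α<g = subst (α <_) (sym length-g) α<m

  split : ∀ {f} → f ∈ E ⇔ f ∈ filter yAt≟0 E ++ map (raiseY α) E′
  split {f} = mk⇔ to from
    where
    to : f ∈ E → f ∈ filter yAt≟0 E ++ map (raiseY α) E′
    to f∈ with yAt α f ≟ 0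
    ... | yes y≡0 = ∈-++⁺ˡ (∈-filter⁺ yAt≟0 f∈ y≡0)
    ... | no  y≢0 with g , refl ← yAt≢0⇒raiseY α f y≢0
                  with length-f , zDegree-f , qDegree-f ← Equivalence.to (∈-excessesℤ m u v) f∈ =
      ∈-++⁺ʳ (filter yAt≟0 E) (∈-map⁺ (raiseY α) (Equivalence.from (∈-excessesℤ m u (v -ℤ + c))
        ( trans (sym (length-raiseY α g)) length-f
        , trans (cong +_ (sym (zDegree-raiseY α g))) zDegree-f
        , +[m+n]≡o⇒+m≡o-n (trans (cong +_ (sym (qDegree-raiseY α 0 g α<g))) qDegree-f))))
      where
      α<g : α < length g
      α<g = subst (α <_) (trans (sym length-f) (length-raiseY α g)) α<m
    from : f ∈ filter yAt≟0 E ++ map (raiseY α) E′ → f ∈ E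
    from f∈ with ∈-++⁻ (filter yAt≟0 E) f∈
    ... | inj₁ f∈filter = proj₁ (∈-filter⁻ yAt≟0 {xs = E} f∈filter)
    ... | inj₂ f∈raised with g , g∈ , refl ← ∈-map⁻ (raiseY α) f∈raised = proj₁ (raised∈E g∈)

  split-unique : Unique (filter yAt≟0 E ++ map (raiseY α) E′)
  split-unique =
    Unique.++⁺ (Unique.filter⁺ yAt≟0 (excessesℤ-unique m u v))
               (Unique.map⁺ (raiseY-injective α) (excessesℤ-unique m u (v -ℤ + c)))
               λ (f∈filter , f∈raised) → disjoint f∈filter f∈raised
    where
    disjoint : ∀ {f} → f ∈ filter yAt≟0 E → f ∈ map (raiseY α) E′ → ⊥
    disjoint f∈filter f∈raised with g , g∈ , refl ← ∈-map⁻ (raiseY α) f∈raised =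
      proj₂ (raised∈E g∈) (proj₂ (∈-filter⁻ yAt≟0 {xs = E} f∈filter))

coefLPS-⊕ : ∀ p r f i j → coefLPS (p ⊕ r) f i j ≡ coefLPS p f i j +ℤ coefLPS r f i j
coefLPS-⊕ []                r f i j = sym (ℤₚ.+-identityˡ _)
coefLPS-⊕ ((c , a , b) ∷ p) r f i j =
  trans (cong (c *ℤ coefAt f (i -ℤ a) (j -ℤ b) +ℤ_) (coefLPS-⊕ p r f i j))
        (sym (ℤₚ.+-assoc (c *ℤ coefAt f (i -ℤ a) (j -ℤ b)) _ _))

coefLPS-concatMap : (g : K → LP) (ks : List K) → ∀ f i j →
  coefLPS (concatMap g ks) f i j ≡ sumℤ (map (λ k → coefLPS (g k) f i j) ks)
coefLPS-concatMap g []       f i j = refl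
coefLPS-concatMap g (k ∷ ks) f i j =
  trans (coefLPS-⊕ (g k) _ f i j) (cong (coefLPS (g k) f i j +ℤ_) (coefLPS-concatMap g ks f i j))

coefLPS-shift : ∀ a b r f i j → coefLPS (mono (+ 1) a b ⊗ r) f i j ≡ coefLPS r f (i -ℤ a) (j -ℤ b)
coefLPS-shift a b []                f i j = refl
coefLPS-shift a b ((c , a′ , b′) ∷ r) f i j =
  cong₂ _+ℤ_ (cong₂ _*ℤ_ (ℤₚ.*-identityˡ c) (cong₂ (coefAt f) (sub-+ i a a′) (sub-+ j b b′)))
             (coefLPS-shift a b r f i j)
  where
  sub-+ : ∀ x y z → x -ℤ (y +ℤ z) ≡ (x -ℤ y) -ℤ z
  sub-+ = ℤ-Solver.solve-∀

coefLPS-mono : ∀ a b f i j → coefLPS (mono (+ 1) a b) f i j ≡ coefAt f (i -ℤ a) (j -ℤ b)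
coefLPS-mono a b f i j = trans (ℤₚ.+-identityʳ _) (ℤₚ.*-identityˡ _)

coefLPS-1-q^ : ∀ c f i j →
  coefLPS (mono (+ 1) (+ 0) (+ 0) ⊕ mono (- + 1) (+ 0) (+ c)) f i j ≡ coefAt f i j -ℤ coefAt f i (j -ℤ + c)
coefLPS-1-q^ c f i j =
  cong₂ _+ℤ_ (trans (ℤₚ.*-identityˡ _) (cong₂ (coefAt f) (ℤₚ.+-identityʳ i) (ℤₚ.+-identityʳ j)))
             (trans (ℤₚ.+-identityʳ _)
               (trans (ℤₚ.-1*i≡-i _) (cong (λ i′ → - coefAt f i′ (j -ℤ + c)) (ℤₚ.+-identityʳ i))))

coefLPS-ΣLP : ∀ m (g : ℕ → LP) f i j → coefLPS (ΣLP m g) f i j ≡ sumℤ (map (λ k → coefLPS (g (suc k)) f i j) (upTo m))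
coefLPS-ΣLP m g f i j = trans (coefLPS-concatMap g (map suc (upTo m)) f i j) (cong sumℤ (sym (Listₚ.map-∘ (upTo m))))

sumℤ-map-concatMap : (h : A → ℤ) (g : K → List A) (ks : List K) →
  sumℤ (map h (concatMap g ks)) ≡ sumℤ (map (λ k → sumℤ (map h (g k))) ks)
sumℤ-map-concatMap h g ks =
  trans (cong sumℤ (Listₚ.map-concatMap h g ks)) (sumℤ-concatMap (map h ∘ g) ks)

sumℤ-map-cong-∈ : {a b : K → ℤ} (ks : List K) → (∀ {k} → k ∈ ks → a k ≡ b k) → sumℤ (map a ks) ≡ sumℤ (map b ks)
sumℤ-map-cong-∈ ks a≡b = cong sumℤ (Listₚ.map-cong-local (All.tabulate a≡b))

shift-down : ∀ {a c m} x → a + c ≡ m → (x -ℤ + m) -ℤ (- + c) ≡ x -ℤ + a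
shift-down {a} {c} x refl = trans (cong (λ m → (x -ℤ m) -ℤ (- + c)) (ℤₚ.pos-+ a c)) (arithmetic x (+ a) (+ c))
  where
  arithmetic : ∀ x a c → (x -ℤ (a +ℤ c)) -ℤ (- c) ≡ x -ℤ a
  arithmetic = ℤ-Solver.solve-∀

shift-up : ∀ {a c m} x → a ≡ m + c → (x -ℤ + m) -ℤ + c ≡ x -ℤ + a
shift-up {c = c} {m} x refl = trans (arithmetic x (+ m) (+ c)) (cong (x -ℤ_) (sym (ℤₚ.pos-+ m c)))
  where
  arithmetic : ∀ x m c → (x -ℤ m) -ℤ c ≡ x -ℤ (m +ℤ c)
  arithmetic = ℤ-Solver.solve-∀

shift-down-difference : ∀ {a p m q} x → a + p ≡ m + q + 2 → (x -ℤ + m) -ℤ (- (+ p -ℤ + q -ℤ + 2)) ≡ x -ℤ + a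
shift-down-difference {a} {p} {m} {q} x eq =
  trans (arithmetic x (+ m) (+ p) (+ q)) (cong (x -ℤ_) (sym (+[m+n]≡o⇒+m≡o-n (trans (cong +_ eq) (pos-+-+ m q 2)))))
  where
  arithmetic : ∀ x m p q → (x -ℤ m) -ℤ (- (p -ℤ q -ℤ + 2)) ≡ x -ℤ ((m +ℤ q +ℤ + 2) -ℤ p)
  arithmetic = ℤ-Solver.solve-∀
  pos-+-+ : ∀ m q c → + (m + q + c) ≡ + m +ℤ + q +ℤ + c
  pos-+-+ m q c = trans (ℤₚ.pos-+ (m + q) c) (cong (_+ℤ + c) (ℤₚ.pos-+ m q))

-- The triple (x , d , y) of the i-th basic unit is
-- (λ_{3i-2} - λ_{3i-1} , λ_{3i-1} - λ_{3i} , λ_{3i} - λ_{3i+1}), with λ_{3k+1} = 0.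
Diff : Set
Diff = ℕ × ℕ × ℕ

head₀ : List ℕ → ℕ
head₀ []      = 0
head₀ (a ∷ _) = a

fromDiffs : List Diff → List ℕ
fromDiffs []                = []
fromDiffs ((x , d , y) ∷ t) = let c = y + head₀ (fromDiffs t) in x + (d + c) ∷ d + c ∷ c ∷ fromDiffs t

toDiffs : List ℕ → List Diff
toDiffs (a ∷ b ∷ c ∷ r) = (a ∸ b , b ∸ c , c ∸ head₀ r) ∷ toDiffs r
toDiffs _               = []

xSum : List Diff → ℕ
xSum []                = 0
xSum ((x , _ , _) ∷ t) = x + xSum t

dSum : List Diff → ℕ
dSum []                = 0
dSum ((_ , d , _) ∷ t) = d + dSum t

isOne : ℕ → ℕ
isOne 1 = 1
isOne _ = 0

dOnes : List Diff → ℕ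
dOnes []                = 0
dOnes ((_ , d , _) ∷ t) = isOne d + dOnes t

total : List Diff → ℕ
total []                = 0
total ((x , d , y) ∷ t) = x + d + y + total t

weight : ℕ → List Diff → ℕ
weight k []                = 0
weight k ((x , d , y) ∷ t) = (3 * k + 1) * x + (3 * k + 2) * d + (3 * k + 3) * y + weight (suc k) t

length-fromDiffs : ∀ t → length (fromDiffs t) ≡ 3 * length t
length-fromDiffs []      = refl
length-fromDiffs (_ ∷ t) = trans (cong (λ l → suc (suc (suc l))) (length-fromDiffs t)) (sym (ℕₚ.*-suc 3 (length t)))

toDiffs-fromDiffs : ∀ t → toDiffs (fromDiffs t) ≡ t
toDiffs-fromDiffs []                = refl
toDiffs-fromDiffs ((x , d , y) ∷ t) =
  cong₂ _∷_ (cong₂ _,_ (ℕₚ.m+n∸n≡m x (d + c)) (cong₂ _,_ (ℕₚ.m+n∸n≡m d c) (ℕₚ.m+n∸n≡m y (head₀ (fromDiffs t)))))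
            (toDiffs-fromDiffs t)
  where
  c : ℕ
  c = y + head₀ (fromDiffs t)

head₀-fromDiffs : ∀ t → head₀ (fromDiffs t) ≡ total t
head₀-fromDiffs []                = refl
head₀-fromDiffs ((x , d , y) ∷ t) rewrite head₀-fromDiffs t = arithmetic x d y (total t)
  where
  arithmetic : ∀ x d y T → x + (d + (y + T)) ≡ x + d + y + T
  arithmetic = solve-∀

weight-suc : ∀ k t → weight (suc k) t ≡ weight k t + 3 * total t
weight-suc k []                = refl
weight-suc k ((x , d , y) ∷ t) rewrite weight-suc (suc k) t = arithmetic k x d y (weight (suc k) t) (total t)
  where
  arithmetic : ∀ k x d y w T →
    (3 * suc k + 1) * x + (3 * suc k + 2) * d + (3 * suc k + 3) * y + (w + 3 * T) ≡
    (3 * k + 1) * x + (3 * k + 2) * d + (3 * k + 3) * y + w + 3 * (x + d + y + T)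
  arithmetic = solve-∀

size-fromDiffs : ∀ t → size (fromDiffs t) ≡ weight 0 t
size-fromDiffs []                = refl
size-fromDiffs ((x , d , y) ∷ t)
  rewrite head₀-fromDiffs t | size-fromDiffs t | weight-suc 0 t = arithmetic x d y (weight 0 t) (total t)
  where
  arithmetic : ∀ x d y S T →
    x + (d + (y + T)) + (d + (y + T) + (y + T + S)) ≡ 1 * x + 2 * d + 3 * y + (S + 3 * T)
  arithmetic = solve-∀

Σ₁-fromDiffs : ∀ t → Σ₁ (fromDiffs t) ≡ + xSum t
Σ₁-fromDiffs []                = refl
Σ₁-fromDiffs ((x , d , y) ∷ t) =
  cong₂ _+ℤ_ (sym (+[m+n]≡o⇒+m≡o-n {x} {d + (y + head₀ (fromDiffs t))} refl)) (Σ₁-fromDiffs t)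

Σ₂-fromDiffs : ∀ t → Σ₂ (fromDiffs t) ≡ + dSum t
Σ₂-fromDiffs []                = refl
Σ₂-fromDiffs ((x , d , y) ∷ t) =
  cong₂ _+ℤ_ (sym (+[m+n]≡o⇒+m≡o-n {d} {y + head₀ (fromDiffs t)} refl)) (Σ₂-fromDiffs t)

private
  isOne≡0 : ∀ d {c} → d + c ≢ suc c → isOne d ≡ 0
  isOne≡0 0             _       = refl
  isOne≡0 1             1+c≢1+c = ⊥-elim (1+c≢1+c refl)
  isOne≡0 (suc (suc d)) _       = refl

  -- Stated for any decision procedure, since the anonymous one inside numUnitsDiff1 cannot be named.
  length-filter-units : {P : Diff → Set} (P? : Decidable P) →
    (∀ {a b c} → P (a , b , c) ⇔ b ≡ suc c) → ∀ t → length (filter P? (units (fromDiffs t))) ≡ dOnes t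
  length-filter-units P? P⇔ [] = refl
  length-filter-units P? P⇔ ((x , d , y) ∷ t)
    with P? (x + (d + (y + head₀ (fromDiffs t))) , d + (y + head₀ (fromDiffs t)) , y + head₀ (fromDiffs t))
  ... | yes p = cong₂ _+_ (cong isOne (sym (ℕₚ.+-cancelʳ-≡ _ d 1 (Equivalence.to P⇔ p)))) (length-filter-units P? P⇔ t)
  ... | no ¬p = cong₂ _+_ (sym (isOne≡0 d (¬p ∘ Equivalence.from P⇔))) (length-filter-units P? P⇔ t)

numUnitsDiff1-fromDiffs : ∀ t → numUnitsDiff1 (fromDiffs t) ≡ dOnes t
numUnitsDiff1-fromDiffs = length-filter-units _ (mk⇔ id id)

-- λ_i > λ_{i+2} throughout, and the last part is positive.
Admissible : List Diff → Set
Admissible []                                 = ⊤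
Admissible ((x , d , y) ∷ [])                 = 1 ≤ x + d × 1 ≤ y
Admissible ((x , d , y) ∷ (x′ , d′ , y′) ∷ t) =
  1 ≤ x + d × 1 ≤ d + y × 1 ≤ y + x′ × Admissible ((x′ , d′ , y′) ∷ t)

NoThreeEqual : List ℕ → Set
NoThreeEqual (a ∷ b ∷ c ∷ r) = a ≢ c × NoThreeEqual (b ∷ c ∷ r)
NoThreeEqual _               = ⊤

private
  1≤⇒+≢ : ∀ p q → 1 ≤ p → p + q ≢ q
  1≤⇒+≢ (suc p) q _ eq = ℕₚ.m+1+n≢m q (trans (ℕₚ.+-comm q (suc p)) eq)

  +≢⇒1≤ : ∀ p q → p + q ≢ q → 1 ≤ p
  +≢⇒1≤ zero    q p+q≢q = ⊥-elim (p+q≢q refl)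
  +≢⇒1≤ (suc p) q _     = s≤s z≤n

  linked-∷ : ∀ {c r} → head₀ r ≤ c → Linked _≥_ r → Linked _≥_ (c ∷ r)
  linked-∷ {r = []}    _   _      = [-]
  linked-∷ {r = _ ∷ _} c≥b sorted = c≥b ∷ sorted

  head₀≤ : ∀ {c r} → Linked _≥_ (c ∷ r) → head₀ r ≤ c
  head₀≤ [-]       = z≤n
  head₀≤ (c≥b ∷ _) = c≥b

  positive-unit : ∀ x d c {r} → 0 < c → All (0 <_) r → All (0 <_) (x + (d + c) ∷ d + c ∷ c ∷ r)
  positive-unit x d c c>0 rest =
    ℕₚ.<-≤-trans c>0 (ℕₚ.≤-trans (ℕₚ.m≤n+m c d) (ℕₚ.m≤n+m _ x))
    ∷ ℕₚ.<-≤-trans c>0 (ℕₚ.m≤n+m c d) ∷ c>0 ∷ rest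

  linked-tail : ∀ {c r} → Linked _≥_ (c ∷ r) → Linked _≥_ r
  linked-tail [-]          = []
  linked-tail (_ ∷ sorted) = sorted

fromDiffs-sorted : ∀ t → Linked _≥_ (fromDiffs t)
fromDiffs-sorted []                = []
fromDiffs-sorted ((x , d , y) ∷ t) =
  ℕₚ.m≤n+m _ x ∷ ℕₚ.m≤n+m _ d ∷ linked-∷ (ℕₚ.m≤n+m _ y) (fromDiffs-sorted t)

fromDiffs-toDiffs : ∀ m μ → length μ ≡ 3 * m → Linked _≥_ μ → fromDiffs (toDiffs μ) ≡ μ
fromDiffs-toDiffs zero    [] _        _      = refl
fromDiffs-toDiffs (suc m) μ  length-μ sorted = unit-by-unit μ (trans length-μ (ℕₚ.*-suc 3 m)) sorted
  where
  unit-by-unit : ∀ μ → length μ ≡ 3 + 3 * m → Linked _≥_ μ → fromDiffs (toDiffs μ) ≡ μ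
  unit-by-unit (a ∷ b ∷ c ∷ r) length-μ (a≥b ∷ b≥c ∷ sorted)
    rewrite fromDiffs-toDiffs m r (ℕₚ.+-cancelˡ-≡ 3 _ _ length-μ) (linked-tail sorted)
    = cong₂ _∷_ a≡ (cong₂ _∷_ b≡ (cong (_∷ r) c≡))
    where
    c≡ : c ∸ head₀ r + head₀ r ≡ c
    c≡ = ℕₚ.m∸n+n≡m (head₀≤ sorted)
    b≡ : b ∸ c + (c ∸ head₀ r + head₀ r) ≡ b
    b≡ = trans (cong (_+_ (b ∸ c)) c≡) (ℕₚ.m∸n+n≡m b≥c)
    a≡ : a ∸ b + (b ∸ c + (c ∸ head₀ r + head₀ r)) ≡ a
    a≡ = trans (cong (_+_ (a ∸ b)) b≡) (ℕₚ.m∸n+n≡m a≥b)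

admissible⇒ : ∀ t → Admissible t → NoThreeEqual (fromDiffs t) × All (0 <_) (fromDiffs t)
admissible⇒ [] _ = tt , []
admissible⇒ ((x , d , y) ∷ []) (x+d≥1 , y≥1) =
  ( (λ eq → 1≤⇒+≢ (x + d) (y + 0) x+d≥1 (trans (ℕₚ.+-assoc x d _) eq)) , tt)
  , positive-unit x d (y + 0) (ℕₚ.≤-trans y≥1 (ℕₚ.m≤m+n y 0)) []
admissible⇒ ((x , d , y) ∷ (x′ , d′ , y′) ∷ t) (x+d≥1 , d+y≥1 , y+x′≥1 , rest)
  with no-three , positive@(a′>0 ∷ _) ← admissible⇒ ((x′ , d′ , y′) ∷ t) rest =
  ( (λ eq → 1≤⇒+≢ (x + d) c x+d≥1 (trans (ℕₚ.+-assoc x d c) eq))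
  , (λ eq → 1≤⇒+≢ (d + y) a′ d+y≥1 (trans (ℕₚ.+-assoc d y a′) eq))
  , (λ eq → 1≤⇒+≢ (y + x′) b′ y+x′≥1 (trans (ℕₚ.+-assoc y x′ b′) eq))
  , no-three)
  , positive-unit x d c c>0 positive
  where
  b′ a′ c : ℕ
  b′ = d′ + (y′ + head₀ (fromDiffs t))
  a′ = x′ + b′
  c  = y + a′
  c>0 : 0 < c
  c>0 = ℕₚ.<-≤-trans a′>0 (ℕₚ.m≤n+m a′ y)

⇒admissible : ∀ t → NoThreeEqual (fromDiffs t) → All (0 <_) (fromDiffs t) → Admissible t
⇒admissible [] _ _ = tt
⇒admissible ((x , d , y) ∷ []) (a≢c , _) (_ ∷ _ ∷ c>0 ∷ _) =
  +≢⇒1≤ (x + d) (y + 0) (λ eq → a≢c (trans (sym (ℕₚ.+-assoc x d _)) eq)) , subst (1 ≤_) (ℕₚ.+-identityʳ y) c>0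
⇒admissible ((x , d , y) ∷ (x′ , d′ , y′) ∷ t) (a≢c , b≢a′ , c≢b′ , no-three) (_ ∷ _ ∷ _ ∷ positive) =
  +≢⇒1≤ (x + d) _ (λ eq → a≢c (trans (sym (ℕₚ.+-assoc x d _)) eq))
  , +≢⇒1≤ (d + y) _ (λ eq → b≢a′ (trans (sym (ℕₚ.+-assoc d y _)) eq))
  , +≢⇒1≤ (y + x′) _ (λ eq → c≢b′ (trans (sym (ℕₚ.+-assoc y x′ _)) eq))
  , ⇒admissible ((x′ , d′ , y′) ∷ t) no-three positive

private
  occurrences : ℕ → List ℕ → ℕ
  occurrences x μ = length (filter (_≟ x) μ)

  occurrences-here : ∀ x μ → occurrences x (x ∷ μ) ≡ suc (occurrences x μ)
  occurrences-here x μ = cong length (Listₚ.filter-accept (_≟ x) refl)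

  occurrences-there : ∀ {x y} μ → y ≢ x → occurrences x (y ∷ μ) ≡ occurrences x μ
  occurrences-there {x} μ y≢x = cong length (Listₚ.filter-reject (_≟ x) y≢x)

  occurrences-below : ∀ {x h} r → Linked _≥_ (h ∷ r) → h < x → occurrences x (h ∷ r) ≡ 0
  occurrences-below {x} {h} r sorted h<x =
    trans (occurrences-there r (λ h≡x → ℕₚ.<-irrefl h≡x h<x)) (rest r sorted)
    where
    rest : ∀ r → Linked _≥_ (h ∷ r) → occurrences x r ≡ 0
    rest []      _                = refl
    rest (h′ ∷ r) (h≥h′ ∷ sorted) = occurrences-below r sorted (ℕₚ.≤-<-trans h≥h′ h<x)

  atMostTwice-tail : ∀ {a r} → AtMostTwice (a ∷ r) → AtMostTwice r
  atMostTwice-tail {a} {r} twice x with a ≟ x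
  ... | yes refl = ℕₚ.≤-trans (ℕₚ.n≤1+n _) (subst (_≤ 2) (occurrences-here a r) (twice a))
  ... | no  a≢x  = subst (_≤ 2) (occurrences-there r a≢x) (twice x)

atMostTwice⇒noThreeEqual : ∀ μ → Linked _≥_ μ → AtMostTwice μ → NoThreeEqual μ
atMostTwice⇒noThreeEqual []              _ _ = tt
atMostTwice⇒noThreeEqual (_ ∷ [])        _ _ = tt
atMostTwice⇒noThreeEqual (_ ∷ _ ∷ [])    _ _ = tt
atMostTwice⇒noThreeEqual (a ∷ b ∷ c ∷ r) (a≥b ∷ b≥c ∷ sorted) twice =
  a≢c , atMostTwice⇒noThreeEqual (b ∷ c ∷ r) (b≥c ∷ sorted) (atMostTwice-tail {a} twice)
  where
  a≢c : a ≢ c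
  a≢c refl with refl ← ℕₚ.≤-antisym a≥b b≥c =
    ℕₚ.<-irrefl refl (ℕₚ.≤-trans (s≤s (s≤s (s≤s z≤n))) (subst (_≤ 2) three (twice a)))
    where
    three : occurrences a (a ∷ a ∷ a ∷ r) ≡ 3 + occurrences a r
    three = trans (occurrences-here a _) (cong suc (trans (occurrences-here a _) (cong suc (occurrences-here a r))))

noThreeEqual⇒atMostTwice : ∀ μ → Linked _≥_ μ → NoThreeEqual μ → AtMostTwice μ
noThreeEqual⇒atMostTwice []      _      _         x = z≤n
noThreeEqual⇒atMostTwice (a ∷ r) sorted no-three x with a ≟ x
... | no  a≢x  = subst (_≤ 2) (sym (occurrences-there r a≢x))
                   (noThreeEqual⇒atMostTwice r (linked-tail sorted) (noThreeEqual-tail r no-three) x)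
  where
  noThreeEqual-tail : ∀ r → NoThreeEqual (a ∷ r) → NoThreeEqual r
  noThreeEqual-tail []              _              = tt
  noThreeEqual-tail (_ ∷ [])        _              = tt
  noThreeEqual-tail (_ ∷ _ ∷ [])    _              = tt
  noThreeEqual-tail (_ ∷ _ ∷ _ ∷ _) (_ , no-three) = no-three
... | yes refl = subst (_≤ 2) (sym (occurrences-here a r)) (s≤s (at-most-once-more r sorted no-three))
  where
  at-most-once-more : ∀ r → Linked _≥_ (a ∷ r) → NoThreeEqual (a ∷ r) → occurrences a r ≤ 1
  at-most-once-more []      _               _ = z≤n
  at-most-once-more (b ∷ r) (a≥b ∷ sorted) no-three with b ≟ a
  ... | no  b≢a  = ℕₚ.≤-trans (ℕₚ.≤-reflexive (occurrences-below r sorted (ℕₚ.≤∧≢⇒< a≥b b≢a))) z≤n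
  ... | yes refl = subst (_≤ 1) (sym (occurrences-here a r)) (s≤s (ℕₚ.≤-reflexive (none r sorted no-three)))
    where
    none : ∀ r → Linked _≥_ (a ∷ r) → NoThreeEqual (a ∷ a ∷ r) → occurrences a r ≡ 0
    none []      _               _         = refl
    none (c ∷ r) (a≥c ∷ sorted) (a≢c , _) = occurrences-below r sorted (ℕₚ.≤∧≢⇒< a≥c (a≢c ∘ sym))

record Valid (n : ℕ) (t : List Diff) : Set where
  field
    length≡    : length t ≡ suc n
    admissible : Admissible t
    dSum≡2     : dSum t ≡ 2
    dOnes≡2    : dOnes t ≡ 2

In𝒜⇒Valid : ∀ n μ → In𝒜 μ → length μ ≡ 3 * suc n → Valid n (toDiffs μ) × fromDiffs (toDiffs μ) ≡ μ
In𝒜⇒Valid n μ ((sorted , positive) , twice , Σ₂≡2 , ones≡2) length-μ = valid , μ≡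
  where
  t : List Diff
  t = toDiffs μ
  μ≡ : fromDiffs t ≡ μ
  μ≡ = fromDiffs-toDiffs (suc n) μ length-μ sorted
  valid : Valid n t
  valid = record
    { length≡    = ℕₚ.*-cancelˡ-≡ (length t) (suc n) 3 (trans (sym (length-fromDiffs t)) (trans (cong length μ≡) length-μ))
    ; admissible = ⇒admissible t (subst NoThreeEqual (sym μ≡) (atMostTwice⇒noThreeEqual μ sorted twice))
                                 (subst (All (0 <_)) (sym μ≡) positive)
    ; dSum≡2     = ℤₚ.+-injective (trans (sym (Σ₂-fromDiffs t)) (trans (cong Σ₂ μ≡) Σ₂≡2))
    ; dOnes≡2    = trans (sym (numUnitsDiff1-fromDiffs t)) (trans (cong numUnitsDiff1 μ≡) ones≡2)
    }

Valid⇒In𝒜 : ∀ n t → Valid n t → In𝒜 (fromDiffs t) × length (fromDiffs t) ≡ 3 * suc n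
Valid⇒In𝒜 n t valid with no-three , positive ← admissible⇒ t (Valid.admissible valid) =
  ( (fromDiffs-sorted t , positive)
  , noThreeEqual⇒atMostTwice (fromDiffs t) (fromDiffs-sorted t) no-three
  , trans (Σ₂-fromDiffs t) (cong +_ dSum≡2)
  , trans (numUnitsDiff1-fromDiffs t) dOnes≡2 )
  , trans (length-fromDiffs t) (cong (3 *_) length≡)
  where open Valid valid

-- The two units with d = 1 are separated by `between g` units with d = 0.  When they are
-- adjacent, λ_{3i} > λ_{3i+2} across them is secured either by the y of the first (adjacentʸ)
-- or, when that y is 0, by the x of the second (adjacentˣ).
data Gap : Set where
  adjacentʸ adjacentˣ : Gap
  apart               : ℕ → Gap

between : Gap → ℕ
between (apart d) = suc d
between _         = 0

firstY : Gap → ℕ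
firstY adjacentʸ = 1
firstY _         = 0

secondX : Gap → ℕ
secondX adjacentˣ = 1
secondX _         = 0

lastY : ℕ → ℕ
lastY zero    = 1
lastY (suc _) = 0

-- (units before the first d = 1 unit , gap , units after the second)
Tag : Set
Tag = ℕ × Gap × ℕ

base : Diff
base = 1 , 0 , 1

minimal : Tag → List Diff
minimal (α , g , β) =
  replicate α base ++ (0 , 1 , firstY g) ∷ replicate (between g) base ++ (secondX g , 1 , lastY β) ∷ replicate β base

width : Tag → ℕ
width (α , g , β) = α + suc (between g + suc β)

addExcess : List Diff → List Excess → List Diff
addExcess []                _             = []
addExcess (_ ∷ _)           []            = []
addExcess ((a , d , b) ∷ π) ((x , y) ∷ f) = (a + x , d , b + y) ∷ addExcess π f

Code : Set
Code = Tag × List Excess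

diffsOf : Code → List Diff
diffsOf (t , f) = addExcess (minimal t) f

encode : Code → List ℕ
encode c = fromDiffs (diffsOf c)

GapCondition : Code → Set
GapCondition ((α , adjacentˣ , _) , f) = yAt α f ≡ 0
GapCondition _                         = ⊤

WellFormed : ℕ → Code → Set
WellFormed n c@(t , f) = width t ≡ suc n × length f ≡ suc n × GapCondition c

length-minimal : ∀ t → length (minimal t) ≡ width t
length-minimal (α , g , β) =
  trans (Listₚ.length-++ (replicate α base))
    (cong₂ _+_ (Listₚ.length-replicate α)
      (cong suc (trans (Listₚ.length-++ (replicate (between g) base))
        (cong₂ _+_ (Listₚ.length-replicate (between g)) (cong suc (Listₚ.length-replicate β))))))

length-addExcess : ∀ π f → length π ≡ length f → length (addExcess π f) ≡ length f
length-addExcess []      []      _  = refl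
length-addExcess (_ ∷ π) (_ ∷ f) eq = cong suc (length-addExcess π f (ℕₚ.suc-injective eq))

addExcess-++ : ∀ π₁ π₂ f₁ f₂ → length π₁ ≡ length f₁ →
  addExcess (π₁ ++ π₂) (f₁ ++ f₂) ≡ addExcess π₁ f₁ ++ addExcess π₂ f₂
addExcess-++ []       π₂ []       f₂ _  = refl
addExcess-++ (_ ∷ π₁) π₂ (_ ∷ f₁) f₂ eq = cong (_ ∷_) (addExcess-++ π₁ π₂ f₁ f₂ (ℕₚ.suc-injective eq))

addExcess-injective : ∀ π f g → length π ≡ length f → length π ≡ length g → addExcess π f ≡ addExcess π g → f ≡ g
addExcess-injective []                []            []              _   _   _  = refl
addExcess-injective ((a , d , b) ∷ π) ((x , y) ∷ f) ((x′ , y′) ∷ g) eqf eqg eq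
  with Listₚ.∷-injective eq
... | head≡ , tail≡ =
  cong₂ _∷_ (cong₂ _,_ (ℕₚ.+-cancelˡ-≡ a x x′ (cong proj₁ head≡))
                       (ℕₚ.+-cancelˡ-≡ b y y′ (cong (proj₂ ∘ proj₂) head≡)))
            (addExcess-injective π f g (ℕₚ.suc-injective eqf) (ℕₚ.suc-injective eqg) tail≡)

xSum-addExcess : ∀ π f → length π ≡ length f → xSum (addExcess π f) ≡ zDegree f + xSum π
xSum-addExcess []                []            _  = refl
xSum-addExcess ((a , d , b) ∷ π) ((x , y) ∷ f) eq rewrite xSum-addExcess π f (ℕₚ.suc-injective eq) =
  arithmetic a x (zDegree f) (xSum π)
  where
  arithmetic : ∀ a x z s → a + x + (z + s) ≡ x + z + (a + s)
  arithmetic = solve-∀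

weight-addExcess : ∀ k π f → length π ≡ length f → weight k (addExcess π f) ≡ qDegree k f + weight k π
weight-addExcess k []                []            _  = refl
weight-addExcess k ((a , d , b) ∷ π) ((x , y) ∷ f) eq rewrite weight-addExcess (suc k) π f (ℕₚ.suc-injective eq) =
  arithmetic k a d b x y (qDegree (suc k) f) (weight (suc k) π)
  where
  arithmetic : ∀ k a d b x y w v →
    (3 * k + 1) * (a + x) + (3 * k + 2) * d + (3 * k + 3) * (b + y) + (w + v) ≡
    (3 * k + 1) * x + (3 * k + 3) * y + w + ((3 * k + 1) * a + (3 * k + 2) * d + (3 * k + 3) * b + v)
  arithmetic = solve-∀

dSum-addExcess : ∀ π f → length π ≡ length f → dSum (addExcess π f) ≡ dSum π
dSum-addExcess []                []      _  = refl
dSum-addExcess ((_ , d , _) ∷ π) (_ ∷ f) eq = cong (_+_ d) (dSum-addExcess π f (ℕₚ.suc-injective eq))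

dOnes-addExcess : ∀ π f → length π ≡ length f → dOnes (addExcess π f) ≡ dOnes π
dOnes-addExcess []                []      _  = refl
dOnes-addExcess ((_ , d , _) ∷ π) (_ ∷ f) eq = cong (_+_ (isOne d)) (dOnes-addExcess π f (ℕₚ.suc-injective eq))

profile : List Diff → List ℕ
profile = map (λ (_ , d , _) → d)

profile-addExcess : ∀ π f → length π ≡ length f → profile (addExcess π f) ≡ profile π
profile-addExcess []                []      _  = refl
profile-addExcess ((_ , d , _) ∷ π) (_ ∷ f) eq = cong (d ∷_) (profile-addExcess π f (ℕₚ.suc-injective eq))

dSum-++ : ∀ u v → dSum (u ++ v) ≡ dSum u + dSum v
dSum-++ []                v = refl
dSum-++ ((_ , d , _) ∷ u) v = trans (cong (_+_ d) (dSum-++ u v)) (sym (ℕₚ.+-assoc d _ _))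

dOnes-++ : ∀ u v → dOnes (u ++ v) ≡ dOnes u + dOnes v
dOnes-++ []                v = refl
dOnes-++ ((_ , d , _) ∷ u) v = trans (cong (_+_ (isOne d)) (dOnes-++ u v)) (sym (ℕₚ.+-assoc (isOne d) _ _))

xSum-++ : ∀ u v → xSum (u ++ v) ≡ xSum u + xSum v
xSum-++ []                v = refl
xSum-++ ((x , _ , _) ∷ u) v = trans (cong (_+_ x) (xSum-++ u v)) (sym (ℕₚ.+-assoc x _ _))

weight-++ : ∀ k u v → weight k (u ++ v) ≡ weight k u + weight (k + length u) v
weight-++ k []                v = cong (λ k′ → weight k′ v) (sym (ℕₚ.+-identityʳ k))
weight-++ k ((x , d , y) ∷ u) v rewrite weight-++ (suc k) u v | ℕₚ.+-suc k (length u) =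
  sym (ℕₚ.+-assoc ((3 * k + 1) * x + (3 * k + 2) * d + (3 * k + 3) * y) (weight (suc k) u) _)

dSum-replicate : ∀ l → dSum (replicate l base) ≡ 0
dSum-replicate zero    = refl
dSum-replicate (suc l) = dSum-replicate l

dOnes-replicate : ∀ l → dOnes (replicate l base) ≡ 0
dOnes-replicate zero    = refl
dOnes-replicate (suc l) = dOnes-replicate l

xSum-replicate : ∀ l → xSum (replicate l base) ≡ l
xSum-replicate zero    = refl
xSum-replicate (suc l) = cong suc (xSum-replicate l)

weight-replicate : ∀ k l → weight k (replicate l base) ≡ 6 * k * l + 3 * l * l + l
weight-replicate k zero = sym (arithmetic k)
  where
  arithmetic : ∀ k → 6 * k * 0 + 3 * 0 * 0 + 0 ≡ 0
  arithmetic = solve-∀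
weight-replicate k (suc l) rewrite weight-replicate (suc k) l = arithmetic k l
  where
  arithmetic : ∀ k l → (3 * k + 1) * 1 + (3 * k + 2) * 0 + (3 * k + 3) * 1 + (6 * suc k * l + 3 * l * l + l)
                       ≡ 6 * k * suc l + 3 * suc l * suc l + suc l
  arithmetic = solve-∀

dSum-minimal : ∀ t → dSum (minimal t) ≡ 2
dSum-minimal (α , g , β)
  rewrite dSum-++ (replicate α base)
                  ((0 , 1 , firstY g) ∷ replicate (between g) base ++ (secondX g , 1 , lastY β) ∷ replicate β base)
        | dSum-++ (replicate (between g) base) ((secondX g , 1 , lastY β) ∷ replicate β base)
        | dSum-replicate α | dSum-replicate (between g) | dSum-replicate β = refl

dOnes-minimal : ∀ t → dOnes (minimal t) ≡ 2
dOnes-minimal (α , g , β)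
  rewrite dOnes-++ (replicate α base)
                  ((0 , 1 , firstY g) ∷ replicate (between g) base ++ (secondX g , 1 , lastY β) ∷ replicate β base)
        | dOnes-++ (replicate (between g) base) ((secondX g , 1 , lastY β) ∷ replicate β base)
        | dOnes-replicate α | dOnes-replicate (between g) | dOnes-replicate β = refl

xSum-minimal : ∀ α g β → xSum (minimal (α , g , β)) ≡ α + (between g + (secondX g + β))
xSum-minimal α g β
  rewrite xSum-++ (replicate α base)
                  ((0 , 1 , firstY g) ∷ replicate (between g) base ++ (secondX g , 1 , lastY β) ∷ replicate β base)
        | xSum-++ (replicate (between g) base) ((secondX g , 1 , lastY β) ∷ replicate β base)
        | xSum-replicate α | xSum-replicate (between g) | xSum-replicate β = refl

weight-minimal : ∀ α g β → weight 0 (minimal (α , g , β)) ≡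
  (3 * α * α + α) + (3 * α + 2 + (3 * α + 3) * firstY g)
  + (6 * suc α * between g + 3 * between g * between g + between g)
  + ((3 * (suc α + between g) + 1) * secondX g + (3 * (suc α + between g) + 2) + (3 * (suc α + between g) + 3) * lastY β)
  + (6 * suc (suc α + between g) * β + 3 * β * β + β)
weight-minimal α g β
  rewrite weight-++ 0 (replicate α base)
                    ((0 , 1 , firstY g) ∷ replicate (between g) base ++ (secondX g , 1 , lastY β) ∷ replicate β base)
        | Listₚ.length-replicate α {base}
        | weight-replicate 0 α
        | weight-++ (suc α) (replicate (between g) base) ((secondX g , 1 , lastY β) ∷ replicate β base)
        | Listₚ.length-replicate (between g) {base}
        | weight-replicate (suc α) (between g)
        | weight-replicate (suc (suc α + between g)) β
  = arithmetic α (between g) β (firstY g) (secondX g) (lastY β)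
  where
  arithmetic : ∀ α δ β s t u →
    6 * 0 * α + 3 * α * α + α +
    ((3 * α + 1) * 0 + (3 * α + 2) * 1 + (3 * α + 3) * s +
     (6 * suc α * δ + 3 * δ * δ + δ +
      ((3 * (suc α + δ) + 1) * t + (3 * (suc α + δ) + 2) * 1 + (3 * (suc α + δ) + 3) * u +
       (6 * suc (suc α + δ) * β + 3 * β * β + β))))
    ≡ (3 * α * α + α) + (3 * α + 2 + (3 * α + 3) * s)
      + (6 * suc α * δ + 3 * δ * δ + δ)
      + ((3 * (suc α + δ) + 1) * t + (3 * (suc α + δ) + 2) + (3 * (suc α + δ) + 3) * u)
      + (6 * suc (suc α + δ) * β + 3 * β * β + β)
  arithmetic = solve-∀

bases : List Excess → List Diff
bases = map (λ (x , y) → suc x , 0 , suc y)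

addExcess-replicate : ∀ f → addExcess (replicate (length f) base) f ≡ bases f
addExcess-replicate []      = refl
addExcess-replicate (_ ∷ f) = cong (_ ∷_) (addExcess-replicate f)

data Split (α δ β : ℕ) : List Excess → Set where
  split : ∀ f₁ x₁ y₁ f₂ x₂ y₂ f₃ → length f₁ ≡ α → length f₂ ≡ δ → length f₃ ≡ β →
          Split α δ β (f₁ ++ (x₁ , y₁) ∷ f₂ ++ (x₂ , y₂) ∷ f₃)

private
  data Split₂ (δ β : ℕ) : List Excess → Set where
    split₂ : ∀ f₂ x₂ y₂ f₃ → length f₂ ≡ δ → length f₃ ≡ β → Split₂ δ β (f₂ ++ (x₂ , y₂) ∷ f₃)

  split₂? : ∀ δ β f → length f ≡ δ + suc β → Split₂ δ β f
  split₂? zero    β ((x₂ , y₂) ∷ f₃) length-f = split₂ [] x₂ y₂ f₃ refl (ℕₚ.suc-injective length-f)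
  split₂? (suc δ) β (e ∷ f)          length-f with split₂? δ β f (ℕₚ.suc-injective length-f)
  ... | split₂ f₂ x₂ y₂ f₃ l₂ l₃ = split₂ (e ∷ f₂) x₂ y₂ f₃ (cong suc l₂) l₃

split? : ∀ α δ β f → length f ≡ α + suc (δ + suc β) → Split α δ β f
split? zero δ β ((x₁ , y₁) ∷ f) length-f with split₂? δ β f (ℕₚ.suc-injective length-f)
... | split₂ f₂ x₂ y₂ f₃ l₂ l₃ = split [] x₁ y₁ f₂ x₂ y₂ f₃ refl l₂ l₃
split? (suc α) δ β (e ∷ f) length-f with split? α δ β f (ℕₚ.suc-injective length-f)
... | split f₁ x₁ y₁ f₂ x₂ y₂ f₃ l₁ l₂ l₃ = split (e ∷ f₁) x₁ y₁ f₂ x₂ y₂ f₃ (cong suc l₁) l₂ l₃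

diffsOf-split : ∀ α g β f₁ x₁ y₁ f₂ x₂ y₂ f₃ →
  length f₁ ≡ α → length f₂ ≡ between g → length f₃ ≡ β →
  diffsOf ((α , g , β) , f₁ ++ (x₁ , y₁) ∷ f₂ ++ (x₂ , y₂) ∷ f₃) ≡
  bases f₁ ++ (x₁ , 1 , firstY g + y₁) ∷ bases f₂ ++ (secondX g + x₂ , 1 , lastY β + y₂) ∷ bases f₃
diffsOf-split _ g β f₁ x₁ y₁ f₂ x₂ y₂ f₃ refl l₂ refl =
  trans (addExcess-++ (replicate (length f₁) base) _ f₁ _ (Listₚ.length-replicate (length f₁)))
        (cong₂ (λ u v → u ++ (x₁ , 1 , firstY g + y₁) ∷ v) (addExcess-replicate f₁)
          (trans (addExcess-++ (replicate (between g) base) _ f₂ _ (trans (Listₚ.length-replicate (between g)) (sym l₂)))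
                 (cong₂ (λ u v → u ++ (secondX g + x₂ , 1 , lastY (length f₃) + y₂) ∷ v)
                        (trans (cong (λ δ → addExcess (replicate δ base) f₂) (sym l₂)) (addExcess-replicate f₂))
                        (addExcess-replicate f₃))))

private
  admissible-bases++ : ∀ f t → Admissible t → Admissible (bases f ++ t)
  admissible-bases++ []            t adm = adm
  admissible-bases++ ((x , y) ∷ f) t adm with bases f ++ t | admissible-bases++ f t adm
  ... | []    | _    = s≤s z≤n , s≤s z≤n
  ... | _ ∷ _ | rest = s≤s z≤n , s≤s z≤n , s≤s z≤n , rest

  StepTo : ℕ → List Diff → Set
  StepTo y []                 = 1 ≤ y
  StepTo y ((x′ , _ , _) ∷ _) = 1 ≤ y + x′

  admissible-step∷ : ∀ x y t → Admissible t → StepTo y t → Admissible ((x , 1 , y) ∷ t)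
  admissible-step∷ x y []      _   step = ℕₚ.m≤n+m 1 x , step
  admissible-step∷ x y (_ ∷ _) adm step = ℕₚ.m≤n+m 1 x , s≤s z≤n , step , adm

  1≤+suc : ∀ y x → 1 ≤ y + suc x
  1≤+suc y x = ℕₚ.≤-trans (s≤s z≤n) (ℕₚ.m≤n+m (suc x) y)

admissible-diffsOf : ∀ t f → length f ≡ width t → Admissible (diffsOf (t , f))
admissible-diffsOf (α , g , β) f length-f with split? α (between g) β f length-f
... | split f₁ x₁ y₁ f₂ x₂ y₂ f₃ refl l₂ l₃
  rewrite diffsOf-split _ g β f₁ x₁ y₁ f₂ x₂ y₂ f₃ refl l₂ l₃ =
  admissible-bases++ f₁ _
    (admissible-step∷ x₁ _ _
      (admissible-bases++ f₂ _
        (admissible-step∷ _ _ (bases f₃)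
          (subst Admissible (Listₚ.++-identityʳ (bases f₃)) (admissible-bases++ f₃ [] tt))
          (second f₃ l₃)))
      (first g f₂ l₂))
  where
  second : ∀ f₃ → length f₃ ≡ β → StepTo (lastY β + y₂) (bases f₃)
  second []            refl = s≤s z≤n
  second ((x , _) ∷ _) _ = 1≤+suc _ x
  first : ∀ g f₂ → length f₂ ≡ between g →
    StepTo (firstY g + y₁) (bases f₂ ++ (secondX g + x₂ , 1 , lastY β + y₂) ∷ bases f₃)
  first g         ((x , _) ∷ _) _ = 1≤+suc _ x
  first adjacentʸ []            _ = s≤s z≤n
  first adjacentˣ []            _ = 1≤+suc y₁ x₂

valid-diffsOf : ∀ n c → WellFormed n c → Valid n (diffsOf c)
valid-diffsOf n (t , f) (width≡ , length-f , _) = record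
  { length≡    = trans (length-addExcess π f π≡f) length-f
  ; admissible = admissible-diffsOf t f (trans length-f (sym width≡))
  ; dSum≡2     = trans (dSum-addExcess π f π≡f) (dSum-minimal t)
  ; dOnes≡2    = trans (dOnes-addExcess π f π≡f) (dOnes-minimal t)
  }
  where
  π : List Diff
  π = minimal t
  π≡f : length π ≡ length f
  π≡f = trans (length-minimal t) (trans width≡ (sym length-f))

profile-minimal : ∀ α g β →
  profile (minimal (α , g , β)) ≡ replicate α 0 ++ 1 ∷ replicate (between g) 0 ++ 1 ∷ replicate β 0
profile-minimal α g β =
  trans (Listₚ.map-++ _ (replicate α base) _)
    (cong₂ _++_ (Listₚ.map-replicate _ α base)
      (cong (1 ∷_) (trans (Listₚ.map-++ _ (replicate (between g) base) _)
        (cong₂ _++_ (Listₚ.map-replicate _ (between g) base) (cong (1 ∷_) (Listₚ.map-replicate _ β base))))))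

private
  replicate-0-1-injective : ∀ a a′ {X X′} → replicate a 0 ++ 1 ∷ X ≡ replicate a′ 0 ++ 1 ∷ X′ → a ≡ a′ × X ≡ X′
  replicate-0-1-injective zero    zero     refl = refl , refl
  replicate-0-1-injective (suc a) (suc a′) eq with refl , X≡X′ ← replicate-0-1-injective a a′ (Listₚ.∷-injectiveʳ eq) =
    refl , X≡X′

yEntry : ℕ → List Diff → ℕ
yEntry _       []                = 0
yEntry zero    ((_ , _ , y) ∷ _) = y
yEntry (suc α) (_ ∷ t)           = yEntry α t

yEntry-diffsOf : ∀ α g β f → length f ≡ width (α , g , β) → yEntry α (diffsOf ((α , g , β) , f)) ≡ firstY g + yAt α f
yEntry-diffsOf α g β f length-f with split? α (between g) β f length-f
... | split f₁ x₁ y₁ f₂ x₂ y₂ f₃ refl l₂ l₃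
  rewrite diffsOf-split _ g β f₁ x₁ y₁ f₂ x₂ y₂ f₃ refl l₂ l₃ =
  trans (yEntry-middle f₁) (cong (_+_ (firstY g)) (sym (yAt-middle f₁)))
  where
  yEntry-middle : ∀ f₁ {r} → yEntry (length f₁) (bases f₁ ++ (x₁ , 1 , firstY g + y₁) ∷ r) ≡ firstY g + y₁
  yEntry-middle []      = refl
  yEntry-middle (_ ∷ f₁) = yEntry-middle f₁
  yAt-middle : ∀ f₁ {r} → yAt (length f₁) (f₁ ++ (x₁ , y₁) ∷ r) ≡ y₁
  yAt-middle []      = refl
  yAt-middle (_ ∷ f₁) = yAt-middle f₁

profile-diffsOf : ∀ α g β f → length f ≡ width (α , g , β) →
  profile (diffsOf ((α , g , β) , f)) ≡ replicate α 0 ++ 1 ∷ replicate (between g) 0 ++ 1 ∷ replicate β 0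
profile-diffsOf α g β f length-f =
  trans (profile-addExcess _ f (trans (length-minimal _) (sym length-f))) (profile-minimal α g β)

private
  same-gap : ∀ {α β f f′} g g′ → between g ≡ between g′ → firstY g + yAt α f ≡ firstY g′ + yAt α f′ →
    GapCondition ((α , g , β) , f) → GapCondition ((α , g′ , β) , f′) → g ≡ g′
  same-gap adjacentʸ adjacentʸ _  _  _   _    = refl
  same-gap adjacentˣ adjacentˣ _  _  _   _    = refl
  same-gap (apart d) (apart d′) eq _  _   _    = cong apart (ℕₚ.suc-injective eq)
  same-gap adjacentʸ adjacentˣ _  y≡ _   y′≡0 = ⊥-elim (ℕₚ.1+n≢0 (trans y≡ y′≡0))
  same-gap adjacentˣ adjacentʸ _  y≡ y≡0 _    = ⊥-elim (ℕₚ.1+n≢0 (trans (sym y≡) y≡0))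

  diffsOf-injective′ : ∀ α g β f α′ g′ β′ f′ →
    length f ≡ width (α , g , β) → length f′ ≡ width (α′ , g′ , β′) →
    GapCondition ((α , g , β) , f) → GapCondition ((α′ , g′ , β′) , f′) →
    diffsOf ((α , g , β) , f) ≡ diffsOf ((α′ , g′ , β′) , f′) → ((α , g , β) , f) ≡ ((α′ , g′ , β′) , f′)
  diffsOf-injective′ α g β f α′ g′ β′ f′ l l′ gc gc′ eq
    with refl , X≡X′ ← replicate-0-1-injective α α′
           (trans (sym (profile-diffsOf α g β f l)) (trans (cong profile eq) (profile-diffsOf α′ g′ β′ f′ l′)))
    with between≡ , rest≡ ← replicate-0-1-injective (between g) (between g′) X≡X′
    with refl ← trans (sym (Listₚ.length-replicate β)) (trans (cong length rest≡) (Listₚ.length-replicate β′))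
    with refl ← same-gap g g′ between≡
                  (trans (sym (yEntry-diffsOf α g β f l)) (trans (cong (yEntry α) eq) (yEntry-diffsOf α g′ β f′ l′))) gc gc′
    = cong ((α , g , β) ,_) (addExcess-injective (minimal (α , g , β)) f f′
        (trans (length-minimal _) (sym l)) (trans (length-minimal _) (sym l′)) eq)

diffsOf-injective : ∀ {n} c c′ → WellFormed n c → WellFormed n c′ → diffsOf c ≡ diffsOf c′ → c ≡ c′
diffsOf-injective ((α , g , β) , f) ((α′ , g′ , β′) , f′) (width≡ , length-f , gc) (width≡′ , length-f′ , gc′) =
  diffsOf-injective′ α g β f α′ g′ β′ f′ (trans length-f (sym width≡)) (trans length-f′ (sym width≡′)) gc gc′

Flat : Diff → Set
Flat (_ , d , _) = d ≡ 0

record TwoSteps (t : List Diff) : Set where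
  constructor twoSteps
  field
    u₁ u₂ u₃    : List Diff
    x₁ y₁ x₂ y₂ : ℕ
    t≡          : t ≡ u₁ ++ (x₁ , 1 , y₁) ∷ u₂ ++ (x₂ , 1 , y₂) ∷ u₃
    flat₁       : All Flat u₁
    flat₂       : All Flat u₂
    flat₃       : All Flat u₃

private
  flat-of-dSum≡0 : ∀ t → dSum t ≡ 0 → All Flat t
  flat-of-dSum≡0 []                   _      = []
  flat-of-dSum≡0 ((_ , zero , _) ∷ t) dSum≡0 = refl ∷ flat-of-dSum≡0 t dSum≡0

  dOnes-flat : ∀ {t} → All Flat t → dOnes t ≡ 0
  dOnes-flat []          = refl
  dOnes-flat (refl ∷ ps) = dOnes-flat ps

  oneStep : ∀ t → dSum t ≡ 1 →
    ∃₂ λ u v → ∃₂ λ x y → t ≡ u ++ (x , 1 , y) ∷ v × All Flat u × All Flat v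
  oneStep ((x , zero , y) ∷ t) dSum≡1 with u , v , x′ , y′ , refl , flat-u , flat-v ← oneStep t dSum≡1 =
    (x , 0 , y) ∷ u , v , x′ , y′ , refl , refl ∷ flat-u , flat-v
  oneStep ((x , 1 , y) ∷ t) dSum≡1 = [] , t , x , y , refl , [] , flat-of-dSum≡0 t (ℕₚ.suc-injective dSum≡1)

twoSteps? : ∀ t → dSum t ≡ 2 → dOnes t ≡ 2 → TwoSteps t
twoSteps? ((x , zero , y) ∷ t) dSum≡2 dOnes≡2
  with twoSteps u₁ u₂ u₃ x₁ y₁ x₂ y₂ refl f₁ f₂ f₃ ← twoSteps? t dSum≡2 dOnes≡2 =
  twoSteps ((x , 0 , y) ∷ u₁) u₂ u₃ x₁ y₁ x₂ y₂ refl (refl ∷ f₁) f₂ f₃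
twoSteps? ((x , 1 , y) ∷ t) dSum≡2 dOnes≡2
  with u₂ , u₃ , x₂ , y₂ , refl , f₂ , f₃ ← oneStep t (ℕₚ.suc-injective dSum≡2) =
  twoSteps [] u₂ u₃ x y x₂ y₂ refl [] f₂ f₃
twoSteps? ((x , 2 , y) ∷ t) dSum≡2 dOnes≡2 =
  ⊥-elim (ℕₚ.1+n≢0 (trans (sym dOnes≡2) (dOnes-flat (flat-of-dSum≡0 t (ℕₚ.+-cancelˡ-≡ 2 _ 0 dSum≡2)))))

BaseBound : Diff → Set
BaseBound (x , d , y) = d ≡ 0 → 1 ≤ x × 1 ≤ y

private
  admissible-tail : ∀ e t → Admissible (e ∷ t) → Admissible t
  admissible-tail _ []      _                 = tt
  admissible-tail _ (_ ∷ _) (_ , _ , _ , adm) = adm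

  admissible-baseBound : ∀ t → Admissible t → All BaseBound t
  admissible-baseBound [] _ = []
  admissible-baseBound ((x , d , y) ∷ []) (x+d≥1 , y≥1) =
    (λ { refl → subst (1 ≤_) (ℕₚ.+-identityʳ x) x+d≥1 , y≥1 }) ∷ []
  admissible-baseBound ((x , d , y) ∷ e ∷ t) (x+d≥1 , d+y≥1 , _ , adm) =
    (λ { refl → subst (1 ≤_) (ℕₚ.+-identityʳ x) x+d≥1 , d+y≥1 }) ∷ admissible-baseBound (e ∷ t) adm

  admissible-step : ∀ u {x d y x′ d′ y′ r} → Admissible (u ++ (x , d , y) ∷ (x′ , d′ , y′) ∷ r) → 1 ≤ y + x′
  admissible-step []      (_ , _ , step , _) = step
  admissible-step (e ∷ u) adm                = admissible-step u (admissible-tail e _ adm)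

  admissible-last : ∀ u {x d y} → Admissible (u ++ (x , d , y) ∷ []) → 1 ≤ y
  admissible-last []      (_ , y≥1) = y≥1
  admissible-last (e ∷ u) adm       = admissible-last u (admissible-tail e _ adm)

debase : List Diff → List Excess
debase = map (λ (x , _ , y) → pred x , pred y)

bases-debase : ∀ u → All Flat u → All BaseBound u → bases (debase u) ≡ u
bases-debase []                _             _               = refl
bases-debase ((x , d , y) ∷ u) (refl ∷ flat) (bound ∷ bounds) with bound refl
... | s≤s _ , s≤s _ = cong (_ ∷_) (bases-debase u flat bounds)

gapOf : ℕ → ℕ → Gap
gapOf (suc d) _       = apart d
gapOf zero    zero    = adjacentˣ
gapOf zero    (suc _) = adjacentʸ

between-gapOf : ∀ δ y → between (gapOf δ y) ≡ δ
between-gapOf zero    zero    = refl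
between-gapOf zero    (suc _) = refl
between-gapOf (suc _) _       = refl

firstY-gapOf : ∀ δ y → firstY (gapOf δ y) + (y ∸ firstY (gapOf δ y)) ≡ y
firstY-gapOf zero    zero    = refl
firstY-gapOf zero    (suc _) = refl
firstY-gapOf (suc _) _       = refl

secondX-gapOf : ∀ δ y x → (δ ≡ 0 → 1 ≤ y + x) → secondX (gapOf δ y) + (x ∸ secondX (gapOf δ y)) ≡ x
secondX-gapOf zero    zero    (suc x) _    = refl
secondX-gapOf zero    zero    zero    step with () ← step refl
secondX-gapOf zero    (suc _) _       _    = refl
secondX-gapOf (suc _) _       _       _    = refl

lastY-fix : ∀ β y → (β ≡ 0 → 1 ≤ y) → lastY β + (y ∸ lastY β) ≡ y
lastY-fix zero    (suc _) _    = refl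
lastY-fix zero    zero    last with () ← last refl
lastY-fix (suc _) _       _    = refl

private
  length-steps : ∀ {A : Set} (u₁ : List A) e₁ u₂ e₂ u₃ →
    length (u₁ ++ e₁ ∷ u₂ ++ e₂ ∷ u₃) ≡ length u₁ + suc (length u₂ + suc (length u₃))
  length-steps u₁ e₁ u₂ e₂ u₃ = trans (Listₚ.length-++ u₁) (cong (λ l → length u₁ + suc l) (Listₚ.length-++ u₂))

  yAt-debase-middle : ∀ u₁ {x y r} → yAt (length u₁) (debase u₁ ++ (x , y) ∷ r) ≡ y
  yAt-debase-middle []      = refl
  yAt-debase-middle (_ ∷ u) = yAt-debase-middle u

  step-across : ∀ u₁ u₂ {x₁ y₁ x₂ y₂ u₃} →
    Admissible (u₁ ++ (x₁ , 1 , y₁) ∷ u₂ ++ (x₂ , 1 , y₂) ∷ u₃) → length u₂ ≡ 0 → 1 ≤ y₁ + x₂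
  step-across u₁ [] adm _ = admissible-step u₁ adm

  last-positive : ∀ u₁ u₂ u₃ {x₁ y₁ x₂ y₂} →
    Admissible (u₁ ++ (x₁ , 1 , y₁) ∷ u₂ ++ (x₂ , 1 , y₂) ∷ u₃) → length u₃ ≡ 0 → 1 ≤ y₂
  last-positive u₁ u₂ [] {x₁} {y₁} {x₂} {y₂} adm _ =
    admissible-last (u₁ ++ (x₁ , 1 , y₁) ∷ u₂)
      (subst Admissible (sym (Listₚ.++-assoc u₁ ((x₁ , 1 , y₁) ∷ u₂) ((x₂ , 1 , y₂) ∷ []))) adm)

  decompose-steps : ∀ n u₁ x₁ y₁ u₂ x₂ y₂ u₃ →
    length (u₁ ++ (x₁ , 1 , y₁) ∷ u₂ ++ (x₂ , 1 , y₂) ∷ u₃) ≡ suc n →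
    Admissible (u₁ ++ (x₁ , 1 , y₁) ∷ u₂ ++ (x₂ , 1 , y₂) ∷ u₃) →
    All Flat u₁ → All Flat u₂ → All Flat u₃ →
    ∃ λ c → WellFormed n c × diffsOf c ≡ u₁ ++ (x₁ , 1 , y₁) ∷ u₂ ++ (x₂ , 1 , y₂) ∷ u₃
  decompose-steps n u₁ x₁ y₁ u₂ x₂ y₂ u₃ length-t adm flat₁ flat₂ flat₃
    with bounds₁ , _ ∷ bounds₂₃ ← All.++⁻ u₁ (admissible-baseBound _ adm)
    with bounds₂ , _ ∷ bounds₃ ← All.++⁻ u₂ bounds₂₃ =
    ((length u₁ , g , length u₃) , f) , (width≡ , length-f , gap-condition (length u₂) y₁) , diffs≡
    where
    g : Gap
    g = gapOf (length u₂) y₁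
    f : List Excess
    f = debase u₁ ++ (x₁ , y₁ ∸ firstY g) ∷ debase u₂ ++ (x₂ ∸ secondX g , y₂ ∸ lastY (length u₃)) ∷ debase u₃

    shape≡ : length u₁ + suc (length u₂ + suc (length u₃)) ≡ suc n
    shape≡ = trans (sym (length-steps u₁ _ u₂ _ u₃)) length-t

    width≡ : width (length u₁ , g , length u₃) ≡ suc n
    width≡ = trans (cong (λ δ → length u₁ + suc (δ + suc (length u₃))) (between-gapOf (length u₂) y₁)) shape≡

    length-f : length f ≡ suc n
    length-f = trans (length-steps (debase u₁) _ (debase u₂) _ (debase u₃))
      (trans (cong₂ (λ a b → a + suc (b + suc (length (debase u₃)))) (Listₚ.length-map _ u₁) (Listₚ.length-map _ u₂))
        (trans (cong (λ c → length u₁ + suc (length u₂ + suc c)) (Listₚ.length-map _ u₃)) shape≡))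

    gap-condition : ∀ δ y → GapCondition ((length u₁ , gapOf δ y , length u₃) ,
      debase u₁ ++ (x₁ , y ∸ firstY (gapOf δ y)) ∷ debase u₂ ++ (x₂ ∸ secondX g , y₂ ∸ lastY (length u₃)) ∷ debase u₃)
    gap-condition zero    zero    = yAt-debase-middle u₁
    gap-condition zero    (suc _) = tt
    gap-condition (suc _) _       = tt

    diffs≡ : diffsOf ((length u₁ , g , length u₃) , f) ≡ u₁ ++ (x₁ , 1 , y₁) ∷ u₂ ++ (x₂ , 1 , y₂) ∷ u₃
    diffs≡ = trans
      (diffsOf-split (length u₁) g (length u₃) (debase u₁) x₁ _ (debase u₂) _ _ (debase u₃)
        (Listₚ.length-map _ u₁) (trans (Listₚ.length-map _ u₂) (sym (between-gapOf (length u₂) y₁)))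
        (Listₚ.length-map _ u₃))
      (cong₂ _++_ (bases-debase u₁ flat₁ bounds₁)
        (cong₂ _∷_ (cong (λ y → x₁ , 1 , y) (firstY-gapOf (length u₂) y₁))
          (cong₂ _++_ (bases-debase u₂ flat₂ bounds₂)
            (cong₂ _∷_ (cong₂ (λ x y → x , 1 , y) (secondX-gapOf (length u₂) y₁ x₂ (step-across u₁ u₂ adm))
                                                   (lastY-fix (length u₃) y₂ (last-positive u₁ u₂ u₃ adm)))
              (bases-debase u₃ flat₃ bounds₃)))))

decompose : ∀ n t → Valid n t → ∃ λ c → WellFormed n c × diffsOf c ≡ t
decompose n t valid
  with twoSteps u₁ u₂ u₃ x₁ y₁ x₂ y₂ refl flat₁ flat₂ flat₃ ←
         twoSteps? t (Valid.dSum≡2 valid) (Valid.dOnes≡2 valid) =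
  decompose-steps n u₁ x₁ y₁ u₂ x₂ y₂ u₃ (Valid.length≡ valid) (Valid.admissible valid) flat₁ flat₂ flat₃

encode-injective : ∀ {n} c c′ → WellFormed n c → WellFormed n c′ → encode c ≡ encode c′ → c ≡ c′
encode-injective c c′ wf wf′ eq =
  diffsOf-injective c c′ wf wf′ (trans (sym (toDiffs-fromDiffs _)) (trans (cong toDiffs eq) (toDiffs-fromDiffs _)))

Σ₁-encode : ∀ t f → length f ≡ width t → Σ₁ (encode (t , f)) ≡ + (zDegree f + xSum (minimal t))
Σ₁-encode t f length-f =
  trans (Σ₁-fromDiffs (diffsOf (t , f))) (cong +_ (xSum-addExcess (minimal t) f (trans (length-minimal t) (sym length-f))))

size-encode : ∀ t f → length f ≡ width t → size (encode (t , f)) ≡ qDegree 0 f + weight 0 (minimal t)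
size-encode t f length-f =
  trans (size-fromDiffs (diffsOf (t , f))) (weight-addExcess 0 (minimal t) f (trans (length-minimal t) (sym length-f)))

xSum-minimal-width : ∀ α g β → xSum (minimal (α , g , β)) + 2 ≡ width (α , g , β) + secondX g
xSum-minimal-width α g β rewrite xSum-minimal α g β = arithmetic α (between g) (secondX g) β
  where
  arithmetic : ∀ α δ s β → α + (δ + (s + β)) + 2 ≡ α + suc (δ + suc β) + s
  arithmetic = solve-∀

-- The tags of width n + 1, listed in the order of the terms of the bracket

adjacentTags : ℕ → ℕ → List Tag
adjacentTags n k = (k , adjacentʸ , n ∸ suc k) ∷ (k , adjacentˣ , n ∸ suc k) ∷ []

apartTag : ℕ → ℕ → ℕ → Tag
apartTag n d k = k , apart d , n ∸ suc k ∸ suc d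

apartTags : ℕ → ℕ → List Tag
apartTags n d = map (apartTag n d) (upTo (n ∸ suc d ∸ 1)) ++ (n ∸ suc d ∸ 1 , apart d , 0) ∷ []

tags : ℕ → List Tag
tags n = concatMap (adjacentTags n) (upTo (n ∸ 1))
         ++ (n ∸ 1 , adjacentʸ , 0) ∷ (n ∸ 1 , adjacentˣ , 0) ∷ concatMap (apartTags n) (upTo (n ∸ 1))

private
  <∸1⇒ : ∀ {k m} → k < m ∸ 1 → ∃ λ o → m ≡ suc k + suc o
  <∸1⇒ {k} {suc m} k<m with o , refl ← ℕₚ.m≤n⇒∃[o]m+o≡n k<m = o , cong suc (sym (ℕₚ.+-suc k o))

  ⇒<∸1 : ∀ k o → k < (suc k + suc o) ∸ 1
  ⇒<∸1 k o = ℕₚ.m<m+n k (s≤s z≤n)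

  width⇒ : ∀ {n} α g β → width (α , g , β) ≡ suc n → n ≡ α + (between g + suc β)
  width⇒ α g β width≡ = ℕₚ.suc-injective (trans (sym width≡) (ℕₚ.+-suc α _))

  apart-after : ∀ d k o → suc d + suc (k + suc o) ∸ suc k ∸ suc d ≡ suc o
  apart-after d k o =
    trans (ℕₚ.∸-+-assoc (suc d + suc (k + suc o)) (suc k) (suc d))
      (trans (cong (_∸ (suc k + suc d)) (arithmetic d k o)) (ℕₚ.m+n∸m≡n (suc k + suc d) (suc o)))
    where
    arithmetic : ∀ d k o → suc d + suc (k + suc o) ≡ suc k + suc d + suc o
    arithmetic = solve-∀

  width-adjacent : ∀ n k → k < n ∸ 1 → k + suc (0 + suc (n ∸ suc k)) ≡ suc n
  width-adjacent n k k<n∸1 with o , refl ← <∸1⇒ {m = n} k<n∸1 rewrite ℕₚ.m+n∸m≡n (suc k) (suc o) = arithmetic k o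
    where
    arithmetic : ∀ k o → k + suc (suc (suc o)) ≡ suc (suc k + suc o)
    arithmetic = solve-∀

  width-last : ∀ n → 1 ≤ n → n ∸ 1 + suc (0 + suc 0) ≡ suc n
  width-last (suc m) _ = ℕₚ.+-comm m 2

  width-apart : ∀ n d k → d < n ∸ 1 → k < n ∸ suc d ∸ 1 → k + suc (suc d + suc (n ∸ suc k ∸ suc d)) ≡ suc n
  width-apart n d k d<n∸1 k<
    with e , refl ← <∸1⇒ {m = n} d<n∸1
    with o , refl ← <∸1⇒ {m = suc e} (subst (λ m → k < m ∸ 1) (ℕₚ.m+n∸m≡n (suc d) (suc e)) k<) =
    trans (cong (λ β → k + suc (suc d + suc β)) (apart-after d k o)) (arithmetic d k o)
    where
    arithmetic : ∀ d k o → k + suc (suc d + suc (suc o)) ≡ suc (suc d + suc (k + suc o))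
    arithmetic = solve-∀

  width-apart-last : ∀ n d → d < n ∸ 1 → n ∸ suc d ∸ 1 + suc (suc d + suc 0) ≡ suc n
  width-apart-last n d d<n∸1 with e , refl ← <∸1⇒ {m = n} d<n∸1
    rewrite ℕₚ.m+n∸m≡n (suc d) (suc e) = arithmetic d e
    where
    arithmetic : ∀ d e → e + suc (suc d + suc 0) ≡ suc (suc d + suc e)
    arithmetic = solve-∀

  apart-canonical : ∀ α d b → α + (suc d + suc (suc b)) ≡ suc d + suc (α + suc b)
  apart-canonical = solve-∀

  apart-last-canonical : ∀ α d → α + (suc d + 1) ≡ suc d + suc α
  apart-last-canonical = solve-∀

tags-sound : ∀ {n t} → 1 ≤ n → t ∈ tags n → width t ≡ suc n
tags-sound {n} 1≤n t∈ with ∈-++⁻ (concatMap (adjacentTags n) (upTo (n ∸ 1))) t∈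
... | inj₁ t∈adjacent
  with k , k∈ , t∈ₖ ← find (∈-concatMap⁻ _ {xs = upTo (n ∸ 1)} t∈adjacent) with t∈ₖ
...   | here refl         = width-adjacent n k (∈-upTo⁻ k∈)
...   | there (here refl) = width-adjacent n k (∈-upTo⁻ k∈)
tags-sound {n} 1≤n t∈ | inj₂ (here refl)         = width-last n 1≤n
tags-sound {n} 1≤n t∈ | inj₂ (there (here refl)) = width-last n 1≤n
tags-sound {n} 1≤n t∈ | inj₂ (there (there t∈apart))
  with d , d∈ , t∈d ← find (∈-concatMap⁻ _ {xs = upTo (n ∸ 1)} t∈apart)
  with ∈-++⁻ (map (apartTag n d) (upTo (n ∸ suc d ∸ 1))) t∈d
... | inj₁ t∈inner with k , k∈ , refl ← ∈-map⁻ (apartTag n d) t∈inner =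
  width-apart n d k (∈-upTo⁻ d∈) (∈-upTo⁻ k∈)
... | inj₂ (here refl) = width-apart-last n d (∈-upTo⁻ d∈)

tags-complete : ∀ n t → width t ≡ suc n → t ∈ tags n
tags-complete n (α , adjacentʸ , suc b) width≡
  with refl ← trans (width⇒ α adjacentʸ (suc b) width≡) (ℕₚ.+-suc α (suc b)) =
  ∈-++⁺ˡ (∈-concatMap⁺ _ (lose (∈-upTo⁺ (⇒<∸1 α b))
    (here (cong (λ β → α , adjacentʸ , β) (sym (ℕₚ.m+n∸m≡n (suc α) (suc b)))))))
tags-complete n (α , adjacentˣ , suc b) width≡
  with refl ← trans (width⇒ α adjacentˣ (suc b) width≡) (ℕₚ.+-suc α (suc b)) =
  ∈-++⁺ˡ (∈-concatMap⁺ _ (lose (∈-upTo⁺ (⇒<∸1 α b))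
    (there (here (cong (λ β → α , adjacentˣ , β) (sym (ℕₚ.m+n∸m≡n (suc α) (suc b))))))))
tags-complete n (α , adjacentʸ , zero) width≡ with refl ← width⇒ α adjacentʸ 0 width≡ =
  ∈-++⁺ʳ _ (here (cong (λ a → a , adjacentʸ , 0) (sym (ℕₚ.m+n∸n≡m α 1))))
tags-complete n (α , adjacentˣ , zero) width≡ with refl ← width⇒ α adjacentˣ 0 width≡ =
  ∈-++⁺ʳ _ (there (here (cong (λ a → a , adjacentˣ , 0) (sym (ℕₚ.m+n∸n≡m α 1)))))
tags-complete n (α , apart d , suc b) width≡
  with refl ← trans (width⇒ α (apart d) (suc b) width≡) (apart-canonical α d b) =
  ∈-++⁺ʳ _ (there (there (∈-concatMap⁺ _ (lose (∈-upTo⁺ (⇒<∸1 d (α + suc b)))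
    (∈-++⁺ˡ (subst (_∈ map (apartTag n d) (upTo (n ∸ suc d ∸ 1))) (cong (λ β → α , apart d , β) (apart-after d α b))
      (∈-map⁺ (apartTag n d)
        (∈-upTo⁺ (subst (λ m → α < m ∸ 1) (sym (ℕₚ.m+n∸m≡n (suc d) (suc (α + suc b)))) (⇒<∸1 α b))))))))))
tags-complete n (α , apart d , zero) width≡
  with refl ← trans (width⇒ α (apart d) 0 width≡) (apart-last-canonical α d) =
  ∈-++⁺ʳ _ (there (there (∈-concatMap⁺ _ (lose (∈-upTo⁺ (⇒<∸1 d α))
    (∈-++⁺ʳ _ (here (cong (λ a → a , apart d , 0) (sym (cong (_∸ 1) (ℕₚ.m+n∸m≡n (suc d) (suc α)))))))))))

private
  IsApart : Gap → Set
  IsApart (apart _) = ⊤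
  IsApart _         = ⊥

  gapOfTag : Tag → Gap
  gapOfTag (_ , g , _) = g

  ∈-adjacentTags : ∀ {n k t} → t ∈ adjacentTags n k → proj₁ t ≡ k × ¬ IsApart (gapOfTag t)
  ∈-adjacentTags (here refl)         = refl , λ ()
  ∈-adjacentTags (there (here refl)) = refl , λ ()

  ∈-apartTags : ∀ {n d t} → t ∈ apartTags n d → gapOfTag t ≡ apart d
  ∈-apartTags {n} {d} t∈ with ∈-++⁻ (map (apartTag n d) (upTo (n ∸ suc d ∸ 1))) t∈
  ... | inj₁ t∈inner with _ , _ , refl ← ∈-map⁻ (apartTag n d) t∈inner = refl
  ... | inj₂ (here refl) = refl

  apartTags-unique : ∀ n d → Unique (apartTags n d)
  apartTags-unique n d =
    Unique.++⁺ (Unique.map⁺ {f = apartTag n d} (cong proj₁) (Unique.upTo⁺ (n ∸ suc d ∸ 1))) (All.[] ∷ [])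
      (λ (t∈inner , t∈last) → inner-short t∈inner t∈last)
    where
    inner-short : ∀ {t} → t ∈ map (apartTag n d) (upTo (n ∸ suc d ∸ 1)) → t ∈ (n ∸ suc d ∸ 1 , apart d , 0) ∷ [] → ⊥
    inner-short t∈ (here refl) with k , k∈ , eq ← ∈-map⁻ (apartTag n d) t∈ =
      ℕₚ.<-irrefl (cong proj₁ (sym eq)) (∈-upTo⁻ k∈)

tags-unique : ∀ n → Unique (tags n)
tags-unique n = Unique.++⁺ adjacent-unique rest-unique (λ (p , q) → disjoint p q)
  where
  adjacent-unique : Unique (concatMap (adjacentTags n) (upTo (n ∸ 1)))
  adjacent-unique =
    unique-concatMap (adjacentTags n) (λ k → ((λ ()) All.∷ All.[]) ∷ All.[] ∷ [])
      (λ p q → trans (sym (proj₁ (∈-adjacentTags {n} p))) (proj₁ (∈-adjacentTags {n} q))) (Unique.upTo⁺ (n ∸ 1))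
  apart-unique : Unique (concatMap (apartTags n) (upTo (n ∸ 1)))
  apart-unique =
    unique-concatMap (apartTags n) (apartTags-unique n)
      (λ p q → ℕₚ.suc-injective (cong between (trans (sym (∈-apartTags {n} p)) (∈-apartTags {n} q)))) (Unique.upTo⁺ (n ∸ 1))
  apart-block : ∀ {t} → t ∈ concatMap (apartTags n) (upTo (n ∸ 1)) → IsApart (gapOfTag t)
  apart-block t∈ with _ , _ , t∈d ← find (∈-concatMap⁻ (apartTags n) {xs = upTo (n ∸ 1)} t∈)
    rewrite ∈-apartTags {n} t∈d = tt
  not-apart : ∀ {t t′} → t′ ∈ concatMap (apartTags n) (upTo (n ∸ 1)) → ¬ IsApart (gapOfTag t) → t ≢ t′
  not-apart t′∈ ¬apart refl = ¬apart (apart-block t′∈)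
  rest-unique : Unique ((n ∸ 1 , adjacentʸ , 0) ∷ (n ∸ 1 , adjacentˣ , 0) ∷ concatMap (apartTags n) (upTo (n ∸ 1)))
  rest-unique =
    ((λ ()) All.∷ All.tabulate (λ t∈ → not-apart t∈ λ ()))
    ∷ All.tabulate (λ t∈ → not-apart t∈ λ ())
    ∷ apart-unique
  disjoint : ∀ {t} → t ∈ concatMap (adjacentTags n) (upTo (n ∸ 1)) →
    t ∈ (n ∸ 1 , adjacentʸ , 0) ∷ (n ∸ 1 , adjacentˣ , 0) ∷ concatMap (apartTags n) (upTo (n ∸ 1)) → ⊥
  disjoint p q with k , k∈ , t∈k ← find (∈-concatMap⁻ (adjacentTags n) {xs = upTo (n ∸ 1)} p) =
    disjoint-k (∈-upTo⁻ k∈) (∈-adjacentTags {n} t∈k) q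
    where
    disjoint-k : ∀ {t k} → k < n ∸ 1 → proj₁ t ≡ k × ¬ IsApart (gapOfTag t) →
      t ∈ (n ∸ 1 , adjacentʸ , 0) ∷ (n ∸ 1 , adjacentˣ , 0) ∷ concatMap (apartTags n) (upTo (n ∸ 1)) → ⊥
    disjoint-k k< (refl , _)     (here refl)         = ℕₚ.<-irrefl refl k<
    disjoint-k k< (refl , _)     (there (here refl)) = ℕₚ.<-irrefl refl k<
    disjoint-k _  (_ , ¬apart)   (there (there q))   = ¬apart (apart-block q)

topDegree : ℕ → ℕ
topDegree n = 3 * n * n + 7 * n + 4

-- The size of the minimal partition of each tag of width n + 1 is the q-exponent of the matching
-- term of F_n times the bracket.
weight-adjacentʸ : ∀ n k → k < n ∸ 1 → weight 0 (minimal (k , adjacentʸ , n ∸ suc k)) + (3 * suc k + 1) ≡ topDegree n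
weight-adjacentʸ n k k<n∸1 with o , refl ← <∸1⇒ {m = n} k<n∸1
  rewrite ℕₚ.m+n∸m≡n (suc k) (suc o) | weight-minimal k adjacentʸ (suc o) = arithmetic k o
  where
  arithmetic : ∀ k o →
    (3 * k * k + k)
    + (3 * k + 2 + (3 * k + 3) * 1)
    + (6 * suc k * 0 + 3 * 0 * 0 + 0)
    + ((3 * (suc k + 0) + 1) * 0 + (3 * (suc k + 0) + 2) + (3 * (suc k + 0) + 3) * 0)
    + (6 * suc (suc k + 0) * suc o + 3 * suc o * suc o + suc o)
    + (3 * suc k + 1)
    ≡ 3 * (suc k + suc o) * (suc k + suc o) + 7 * (suc k + suc o) + 4
  arithmetic = solve-∀

weight-adjacentˣ : ∀ n k → k < n ∸ 1 → weight 0 (minimal (k , adjacentˣ , n ∸ suc k)) + 3 * suc k ≡ topDegree n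
weight-adjacentˣ n k k<n∸1 with o , refl ← <∸1⇒ {m = n} k<n∸1
  rewrite ℕₚ.m+n∸m≡n (suc k) (suc o) | weight-minimal k adjacentˣ (suc o) = arithmetic k o
  where
  arithmetic : ∀ k o →
    (3 * k * k + k)
    + (3 * k + 2 + (3 * k + 3) * 0)
    + (6 * suc k * 0 + 3 * 0 * 0 + 0)
    + ((3 * (suc k + 0) + 1) * 1 + (3 * (suc k + 0) + 2) + (3 * (suc k + 0) + 3) * 0)
    + (6 * suc (suc k + 0) * suc o + 3 * suc o * suc o + suc o)
    + 3 * suc k
    ≡ 3 * (suc k + suc o) * (suc k + suc o) + 7 * (suc k + suc o) + 4
  arithmetic = solve-∀

weight-lastʸ : ∀ n → 1 ≤ n → weight 0 (minimal (n ∸ 1 , adjacentʸ , 0)) ≡ topDegree n + 2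
weight-lastʸ (suc m) _ rewrite weight-minimal m adjacentʸ 0 = arithmetic m
  where
  arithmetic : ∀ m →
    (3 * m * m + m)
    + (3 * m + 2 + (3 * m + 3) * 1)
    + (6 * suc m * 0 + 3 * 0 * 0 + 0)
    + ((3 * (suc m + 0) + 1) * 0 + (3 * (suc m + 0) + 2) + (3 * (suc m + 0) + 3) * 1)
    + (6 * suc (suc m + 0) * 0 + 3 * 0 * 0 + 0)
    ≡ 3 * (suc m) * (suc m) + 7 * (suc m) + 4 + 2
  arithmetic = solve-∀

weight-lastˣ : ∀ n → 1 ≤ n → weight 0 (minimal (n ∸ 1 , adjacentˣ , 0)) ≡ topDegree n + 3
weight-lastˣ (suc m) _ rewrite weight-minimal m adjacentˣ 0 = arithmetic m
  where
  arithmetic : ∀ m →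
    (3 * m * m + m)
    + (3 * m + 2 + (3 * m + 3) * 0)
    + (6 * suc m * 0 + 3 * 0 * 0 + 0)
    + ((3 * (suc m + 0) + 1) * 1 + (3 * (suc m + 0) + 2) + (3 * (suc m + 0) + 3) * 1)
    + (6 * suc (suc m + 0) * 0 + 3 * 0 * 0 + 0)
    ≡ 3 * (suc m) * (suc m) + 7 * (suc m) + 4 + 3
  arithmetic = solve-∀

weight-apart : ∀ n d k → d < n ∸ 1 → k < n ∸ suc d ∸ 1 →
  weight 0 (minimal (apartTag n d k)) + (6 * suc k + 3 * suc d + 1) ≡ topDegree n
weight-apart n d k d<n∸1 k<
  with e , refl ← <∸1⇒ {m = n} d<n∸1
  with o , refl ← <∸1⇒ {m = suc e} (subst (λ m → k < m ∸ 1) (ℕₚ.m+n∸m≡n (suc d) (suc e)) k<)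
  rewrite apart-after d k o | weight-minimal k (apart d) (suc o) = arithmetic k d o
  where
  arithmetic : ∀ k d o →
    (3 * k * k + k)
    + (3 * k + 2 + (3 * k + 3) * 0)
    + (6 * suc k * suc d + 3 * suc d * suc d + suc d)
    + ((3 * (suc k + suc d) + 1) * 0 + (3 * (suc k + suc d) + 2) + (3 * (suc k + suc d) + 3) * 0)
    + (6 * suc (suc k + suc d) * suc o + 3 * suc o * suc o + suc o)
    + (6 * suc k + 3 * suc d + 1)
    ≡ 3 * (suc d + suc (k + suc o)) * (suc d + suc (k + suc o)) + 7 * (suc d + suc (k + suc o)) + 4
  arithmetic = solve-∀

weight-apart-last : ∀ n d → d < n ∸ 1 →
  weight 0 (minimal (n ∸ suc d ∸ 1 , apart d , 0)) + 3 * n ≡ topDegree n + 3 * suc d + 2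
weight-apart-last n d d<n∸1 with e , refl ← <∸1⇒ {m = n} d<n∸1
  rewrite ℕₚ.m+n∸m≡n (suc d) (suc e) | weight-minimal e (apart d) 0 = arithmetic d e
  where
  arithmetic : ∀ d e →
    (3 * e * e + e)
    + (3 * e + 2 + (3 * e + 3) * 0)
    + (6 * suc e * suc d + 3 * suc d * suc d + suc d)
    + ((3 * (suc e + suc d) + 1) * 0 + (3 * (suc e + suc d) + 2) + (3 * (suc e + suc d) + 3) * 1)
    + (6 * suc (suc e + suc d) * 0 + 3 * 0 * 0 + 0)
    + 3 * (suc d + suc e)
    ≡ 3 * (suc d + suc e) * (suc d + suc e) + 7 * (suc d + suc e) + 4 + 3 * suc d + 2
  arithmetic = solve-∀

3*[1+n]≡3*n+3 : ∀ n → 3 * suc n ≡ 3 * n + 3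
3*[1+n]≡3*n+3 = solve-∀

adjacentTerm : ℕ → LP
adjacentTerm k =
  mono (+ 1) (- + 2) (- (+ (3 * k + 1)))
  ⊕ (mono (+ 1) (- + 1) (- + (3 * k)) ⊗ (mono (+ 1) (+ 0) (+ 0) ⊕ mono (- + 1) (+ 0) (+ (3 * k))))

lastʸTerm : LP
lastʸTerm = mono (+ 1) (- + 2) (+ 2)

lastˣTerm : ℕ → LP
lastˣTerm n = mono (+ 1) (- + 1) (+ 3) ⊗ (mono (+ 1) (+ 0) (+ 0) ⊕ mono (- + 1) (+ 0) (+ (3 * n)))

apartInnerTerm : ℕ → ℕ → LP
apartInnerTerm d k = mono (+ 1) (- + 2) (- (+ (6 * k + 3 * d + 1)))

apartLastTerm : ℕ → ℕ → LP
apartLastTerm n d = mono (+ 1) (- + 2) (- (+ (3 * n) -ℤ + (3 * d) -ℤ + 2))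

apartTerm : ℕ → ℕ → LP
apartTerm n d = ΣLP (n ∸ d ∸ 1) (apartInnerTerm d) ⊕ apartLastTerm n d

coefLPS-bracket : ∀ n f i j → coefLPS (bracket n) f i j ≡
  coefLPS (ΣLP (n ∸ 1) adjacentTerm) f i j
  +ℤ (coefLPS lastʸTerm f i j +ℤ (coefLPS (lastˣTerm n) f i j +ℤ coefLPS (ΣLP (n ∸ 1) (apartTerm n)) f i j))
coefLPS-bracket n f i j =
  trans (coefLPS-⊕ (ΣLP (n ∸ 1) adjacentTerm) (lastʸTerm ⊕ lastˣTerm n ⊕ ΣLP (n ∸ 1) (apartTerm n)) f i j)
    (cong (_+ℤ_ (coefLPS (ΣLP (n ∸ 1) adjacentTerm) f i j))
      (trans (coefLPS-⊕ lastʸTerm (lastˣTerm n ⊕ ΣLP (n ∸ 1) (apartTerm n)) f i j)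
        (cong (_+ℤ_ (coefLPS lastʸTerm f i j)) (coefLPS-⊕ (lastˣTerm n) (ΣLP (n ∸ 1) (apartTerm n)) f i j))))

module _ (n : ℕ) (i j : ℤ) where

  restrict : Tag → List (List Excess) → List (List Excess)
  restrict (α , adjacentˣ , _) = filter (λ f → yAt α f ≟ 0)
  restrict _                   = id

  zShift qShift : Tag → ℤ
  zShift t = i -ℤ + xSum (minimal t)
  qShift t = j -ℤ + weight 0 (minimal t)

  excessesOf : Tag → List (List Excess)
  excessesOf t = excessesℤ (suc n) (zShift t) (qShift t)

  candidates : Tag → List (List Excess)
  candidates t = restrict t (excessesOf t)

  Fits : Tag → List Excess → Set
  Fits t f = length f ≡ suc n × + zDegree f ≡ zShift t × + qDegree 0 f ≡ qShift t

  leaf : Tag → List Code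
  leaf t = map (t ,_) (candidates t)

  codes : List Code
  codes = concatMap leaf (tags n)

  ∈-excessesOf : ∀ t {f} → f ∈ excessesOf t ⇔ Fits t f
  ∈-excessesOf t = ∈-excessesℤ (suc n) (zShift t) (qShift t)

  ∈-candidates : ∀ t {f} → f ∈ candidates t ⇔ (Fits t f × GapCondition (t , f))
  ∈-candidates t@(α , adjacentˣ , β) =
    mk⇔ (λ f∈ → let f∈E , y≡0 = ∈-filter⁻ (λ f → yAt α f ≟ 0) {xs = excessesOf t} f∈
                 in Equivalence.to (∈-excessesOf t) f∈E , y≡0)
        (λ (fits , y≡0) → ∈-filter⁺ (λ f → yAt α f ≟ 0) (Equivalence.from (∈-excessesOf t) fits) y≡0)
  ∈-candidates t@(α , adjacentʸ , β) =
    mk⇔ (λ f∈ → Equivalence.to (∈-excessesOf t) f∈ , tt) (Equivalence.from (∈-excessesOf t) ∘ proj₁)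
  ∈-candidates t@(α , apart d , β) =
    mk⇔ (λ f∈ → Equivalence.to (∈-excessesOf t) f∈ , tt) (Equivalence.from (∈-excessesOf t) ∘ proj₁)

  candidates-unique : ∀ t → Unique (candidates t)
  candidates-unique t@(α , adjacentˣ , β) = Unique.filter⁺ (λ f → yAt α f ≟ 0) (excessesℤ-unique (suc n) (zShift t) (qShift t))
  candidates-unique t@(α , adjacentʸ , β) = excessesℤ-unique (suc n) (zShift t) (qShift t)
  candidates-unique t@(α , apart d , β)   = excessesℤ-unique (suc n) (zShift t) (qShift t)

  ∈-codes⁻ : ∀ {t f} → (t , f) ∈ codes → t ∈ tags n × f ∈ candidates t
  ∈-codes⁻ c∈ with t , t∈ , c∈t ← find (∈-concatMap⁻ leaf {xs = tags n} c∈)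
              with f , f∈ , refl ← ∈-map⁻ (t ,_) c∈t = t∈ , f∈

  ∈-codes⁺ : ∀ {t f} → t ∈ tags n → f ∈ candidates t → (t , f) ∈ codes
  ∈-codes⁺ {t} t∈ f∈ = ∈-concatMap⁺ leaf (lose t∈ (∈-map⁺ (t ,_) f∈))

  codes-unique : Unique codes
  codes-unique =
    unique-concatMap leaf (λ t → Unique.map⁺ (cong proj₂) (candidates-unique t)) tag-of (tags-unique n)
    where
    tag-of : ∀ {t t′ c} → c ∈ leaf t → c ∈ leaf t′ → t ≡ t′
    tag-of c∈ c∈′ with _ , _ , refl ← ∈-map⁻ _ c∈ with _ , _ , refl ← ∈-map⁻ _ c∈′ = refl

  codes-wellFormed : 1 ≤ n → ∀ {c} → c ∈ codes → WellFormed n c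
  codes-wellFormed 1≤n {t , f} c∈ = tags-sound 1≤n (proj₁ t∈f∈) , proj₁ (proj₁ facts) , proj₂ facts
    where
    t∈f∈ : t ∈ tags n × f ∈ candidates t
    t∈f∈ = ∈-codes⁻ c∈
    facts : Fits t f × GapCondition (t , f)
    facts = Equivalence.to (∈-candidates t) (proj₂ t∈f∈)

  Counted : List ℕ → Set
  Counted μ = In𝒜 μ × length μ ≡ 3 * n + 3 × Σ₁ μ ≡ i × + size μ ≡ j

  encode-sound : 1 ≤ n → ∀ {c} → c ∈ codes → Counted (encode c)
  encode-sound 1≤n {t , f} c∈ =
    proj₁ in𝒜×length , trans (proj₂ in𝒜×length) (3*[1+n]≡3*n+3 n)
    , trans (Σ₁-encode t f length≡width) (+m≡o-n⇒+[m+n]≡o (proj₁ (proj₂ degrees)))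
    , trans (cong +_ (size-encode t f length≡width)) (+m≡o-n⇒+[m+n]≡o (proj₂ (proj₂ degrees)))
    where
    t∈f∈ : t ∈ tags n × f ∈ candidates t
    t∈f∈ = ∈-codes⁻ c∈
    degrees : Fits t f
    degrees = proj₁ (Equivalence.to (∈-candidates t) (proj₂ t∈f∈))
    length≡width : length f ≡ width t
    length≡width = trans (proj₁ degrees) (sym (tags-sound 1≤n (proj₁ t∈f∈)))
    in𝒜×length : In𝒜 (encode (t , f)) × length (encode (t , f)) ≡ 3 * suc n
    in𝒜×length = Valid⇒In𝒜 n (diffsOf (t , f)) (valid-diffsOf n (t , f) (codes-wellFormed 1≤n c∈))

  encode-complete : ∀ μ → Counted μ → ∃ λ c → c ∈ codes × encode c ≡ μ
  encode-complete μ (in𝒜 , length-μ , Σ₁≡i , size≡j) =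
    (t , f) , ∈-codes⁺ (tags-complete n t width≡) (Equivalence.from (∈-candidates t) ((length-f , z≡ , q≡) , gap)) , encode≡
    where
    valid×μ≡ : Valid n (toDiffs μ) × fromDiffs (toDiffs μ) ≡ μ
    valid×μ≡ = In𝒜⇒Valid n μ in𝒜 (trans length-μ (sym (3*[1+n]≡3*n+3 n)))
    decomposition : ∃ λ c → WellFormed n c × diffsOf c ≡ toDiffs μ
    decomposition = decompose n (toDiffs μ) (proj₁ valid×μ≡)
    t : Tag
    t = proj₁ (proj₁ decomposition)
    f : List Excess
    f = proj₂ (proj₁ decomposition)
    width≡ : width t ≡ suc n
    width≡ = proj₁ (proj₁ (proj₂ decomposition))
    length-f : length f ≡ suc n
    length-f = proj₁ (proj₂ (proj₁ (proj₂ decomposition)))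
    gap : GapCondition (t , f)
    gap = proj₂ (proj₂ (proj₁ (proj₂ decomposition)))
    encode≡ : encode (t , f) ≡ μ
    encode≡ = trans (cong fromDiffs (proj₂ (proj₂ decomposition))) (proj₂ valid×μ≡)
    length≡width : length f ≡ width t
    length≡width = trans length-f (sym width≡)
    z≡ : + zDegree f ≡ zShift t
    z≡ = +[m+n]≡o⇒+m≡o-n (trans (sym (Σ₁-encode t f length≡width)) (trans (cong Σ₁ encode≡) Σ₁≡i))
    q≡ : + qDegree 0 f ≡ qShift t
    q≡ = +[m+n]≡o⇒+m≡o-n
      (trans (cong +_ (sym (size-encode t f length≡width))) (trans (cong (λ ν → + size ν) encode≡) size≡j))

  P : PS
  P = pochInv (suc n)

  count : Tag → ℤ
  count t = + length (candidates t)

  i′ j′ : ℤ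
  i′ = i -ℤ + suc n
  j′ = j -ℤ + topDegree n

  count-excesses : ∀ α g β → secondX g ≡ 0 → count (α , g , β) ≡ coefAt P (zShift (α , g , β)) (qShift (α , g , β))
  count-excesses α adjacentʸ β _ = sym (excessesℤ-counts (suc n) (zShift (α , adjacentʸ , β)) (qShift (α , adjacentʸ , β)))
  count-excesses α (apart d) β _ = sym (excessesℤ-counts (suc n) (zShift (α , apart d , β)) (qShift (α , apart d , β)))

  count-adjacentˣ : ∀ α β → α < suc n → let t = (α , adjacentˣ , β) in
    count t ≡ coefAt P (zShift t) (qShift t) -ℤ coefAt P (zShift t) (qShift t -ℤ + (3 * suc α))
  count-adjacentˣ α β α<1+n =
    trans (length-filter-yAt≡0 (zShift t) (qShift t) α<1+n)
          (sym (cong₂ _-ℤ_ (excessesℤ-counts (suc n) (zShift t) (qShift t))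
                           (excessesℤ-counts (suc n) (zShift t) (qShift t -ℤ + (3 * suc α)))))
    where
    t : Tag
    t = α , adjacentˣ , β

  zShift-two : ∀ α g β → secondX g ≡ 0 → width (α , g , β) ≡ suc n → zShift (α , g , β) ≡ i′ -ℤ (- + 2)
  zShift-two α g β secondX≡0 width≡ =
    sym (shift-down i (trans (xSum-minimal-width α g β) (trans (cong₂ _+_ width≡ secondX≡0) (ℕₚ.+-identityʳ (suc n)))))

  zShift-one : ∀ α β → width (α , adjacentˣ , β) ≡ suc n → zShift (α , adjacentˣ , β) ≡ i′ -ℤ (- + 1)
  zShift-one α β width≡ =
    sym (shift-down i (ℕₚ.+-cancelʳ-≡ 1 _ (suc n)
      (trans (ℕₚ.+-assoc (xSum (minimal (α , adjacentˣ , β))) 1 1)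
        (trans (xSum-minimal-width α adjacentˣ β) (cong (_+ 1) width≡)))))

  adjacent-term : 1 ≤ n → ∀ k → k < n ∸ 1 →
    sumℤ (map count (adjacentTags n k)) ≡ coefLPS (adjacentTerm (suc k)) P i′ j′
  adjacent-term 1≤n k k<n∸1 = sym (begin
    coefLPS (first ⊕ second) P i′ j′
      ≡⟨ coefLPS-⊕ first second P i′ j′ ⟩
    coefLPS first P i′ j′ +ℤ coefLPS second P i′ j′
      ≡⟨ cong₂ _+ℤ_ first≡ second≡ ⟩
    count tʸ +ℤ count tˣ
      ≡⟨ cong (count tʸ +ℤ_) (sym (ℤₚ.+-identityʳ (count tˣ))) ⟩
    count tʸ +ℤ (count tˣ +ℤ + 0) ∎)
    where
    open ≡-Reasoning
    tʸ tˣ : Tag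
    tʸ = k , adjacentʸ , n ∸ suc k
    tˣ = k , adjacentˣ , n ∸ suc k
    first second : LP
    first  = mono (+ 1) (- + 2) (- (+ (3 * suc k + 1)))
    second = mono (+ 1) (- + 1) (- + (3 * suc k)) ⊗ (mono (+ 1) (+ 0) (+ 0) ⊕ mono (- + 1) (+ 0) (+ (3 * suc k)))
    first≡ : coefLPS first P i′ j′ ≡ count tʸ
    first≡ = trans (coefLPS-mono (- + 2) (- (+ (3 * suc k + 1))) P i′ j′)
      (trans (cong₂ (coefAt P) (sym (zShift-two k adjacentʸ _ refl (width-adjacent n k k<n∸1)))
                               (shift-down j (weight-adjacentʸ n k k<n∸1)))
             (sym (count-excesses k adjacentʸ _ refl)))
    u≡ : i′ -ℤ (- + 1) ≡ zShift tˣ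
    u≡ = sym (zShift-one k _ (width-adjacent n k k<n∸1))
    v≡ : j′ -ℤ (- + (3 * suc k)) ≡ qShift tˣ
    v≡ = shift-down j (weight-adjacentˣ n k k<n∸1)
    second≡ : coefLPS second P i′ j′ ≡ count tˣ
    second≡ = trans (coefLPS-shift (- + 1) (- + (3 * suc k)) (mono (+ 1) (+ 0) (+ 0) ⊕ mono (- + 1) (+ 0) (+ (3 * suc k))) P i′ j′)
      (trans (coefLPS-1-q^ (3 * suc k) P (i′ -ℤ (- + 1)) (j′ -ℤ (- + (3 * suc k))))
        (trans (cong₂ (λ u v → coefAt P u v -ℤ coefAt P u (v -ℤ + (3 * suc k))) u≡ v≡)
               (sym (count-adjacentˣ k _ (ℕₚ.<-trans (ℕₚ.<-≤-trans k<n∸1 (ℕₚ.m∸n≤m n 1)) (ℕₚ.n<1+n n))))))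

  lastʸ-term : 1 ≤ n → count (n ∸ 1 , adjacentʸ , 0) ≡ coefLPS lastʸTerm P i′ j′
  lastʸ-term 1≤n = sym (trans (coefLPS-mono (- + 2) (+ 2) P i′ j′)
    (trans (cong₂ (coefAt P) (sym (zShift-two (n ∸ 1) adjacentʸ 0 refl (width-last n 1≤n)))
                             (shift-up j (weight-lastʸ n 1≤n)))
           (sym (count-excesses (n ∸ 1) adjacentʸ 0 refl))))

  lastˣ-term : 1 ≤ n →
    count (n ∸ 1 , adjacentˣ , 0) ≡ coefLPS (lastˣTerm n) P i′ j′
  lastˣ-term 1≤n = sym (trans (coefLPS-shift (- + 1) (+ 3) (mono (+ 1) (+ 0) (+ 0) ⊕ mono (- + 1) (+ 0) (+ (3 * n))) P i′ j′)
    (trans (coefLPS-1-q^ (3 * n) P (i′ -ℤ (- + 1)) (j′ -ℤ + 3))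
      (trans (cong (λ m → coefAt P u v -ℤ coefAt P u (v -ℤ + (3 * m))) (sym (ℕₚ.m+[n∸m]≡n 1≤n)))
        (trans (cong₂ (λ u v → coefAt P u v -ℤ coefAt P u (v -ℤ + (3 * suc (n ∸ 1))))
                      (sym (zShift-one (n ∸ 1) 0 (width-last n 1≤n))) (shift-up j (weight-lastˣ n 1≤n)))
               (sym (count-adjacentˣ (n ∸ 1) 0 (s≤s (ℕₚ.m∸n≤m n 1))))))))
    where
    u v : ℤ
    u = i′ -ℤ (- + 1)
    v = j′ -ℤ + 3

  apart-inner-term : ∀ d → d < n ∸ 1 → ∀ k → k < n ∸ suc d ∸ 1 →
    count (apartTag n d k) ≡ coefLPS (apartInnerTerm (suc d) (suc k)) P i′ j′
  apart-inner-term d d<n∸1 k k< = sym (trans (coefLPS-mono (- + 2) (- (+ (6 * suc k + 3 * suc d + 1))) P i′ j′)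
    (trans (cong₂ (coefAt P) (sym (zShift-two k (apart d) _ refl (width-apart n d k d<n∸1 k<)))
                             (shift-down j (weight-apart n d k d<n∸1 k<)))
           (sym (count-excesses k (apart d) _ refl))))

  apart-last-term : ∀ d → d < n ∸ 1 →
    count (n ∸ suc d ∸ 1 , apart d , 0) ≡ coefLPS (apartLastTerm n (suc d)) P i′ j′
  apart-last-term d d<n∸1 = sym (trans (coefLPS-mono (- + 2) (- (+ (3 * n) -ℤ + (3 * suc d) -ℤ + 2)) P i′ j′)
    (trans (cong₂ (coefAt P) (sym (zShift-two (n ∸ suc d ∸ 1) (apart d) 0 refl (width-apart-last n d d<n∸1)))
                             (shift-down-difference j (weight-apart-last n d d<n∸1)))
           (sym (count-excesses (n ∸ suc d ∸ 1) (apart d) 0 refl))))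

  apart-term : ∀ d → d < n ∸ 1 →
    sumℤ (map count (apartTags n d)) ≡ coefLPS (apartTerm n (suc d)) P i′ j′
  apart-term d d<n∸1 = begin
    sumℤ (map count (apartTags n d))
      ≡⟨ cong sumℤ (Listₚ.map-++ count (map (apartTag n d) ks) _) ⟩
    sumℤ (map count (map (apartTag n d) ks) ++ count tₗ ∷ [])
      ≡⟨ sumℤ-++ (map count (map (apartTag n d) ks)) _ ⟩
    sumℤ (map count (map (apartTag n d) ks)) +ℤ (count tₗ +ℤ + 0)
      ≡⟨ cong₂ _+ℤ_ (cong sumℤ (sym (Listₚ.map-∘ ks))) (ℤₚ.+-identityʳ (count tₗ)) ⟩
    sumℤ (map (count ∘ apartTag n d) ks) +ℤ count tₗ
      ≡⟨ cong₂ _+ℤ_ (sumℤ-map-cong-∈ ks (λ k∈ → apart-inner-term d d<n∸1 _ (∈-upTo⁻ k∈))) (apart-last-term d d<n∸1) ⟩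
    sumℤ (map (λ k → coefLPS (apartInnerTerm (suc d) (suc k)) P i′ j′) ks) +ℤ coefLPS (apartLastTerm n (suc d)) P i′ j′
      ≡⟨ cong (_+ℤ coefLPS (apartLastTerm n (suc d)) P i′ j′) (sym (coefLPS-ΣLP (n ∸ suc d ∸ 1) (apartInnerTerm (suc d)) P i′ j′)) ⟩
    coefLPS (ΣLP (n ∸ suc d ∸ 1) (apartInnerTerm (suc d))) P i′ j′ +ℤ coefLPS (apartLastTerm n (suc d)) P i′ j′
      ≡⟨ sym (coefLPS-⊕ (ΣLP (n ∸ suc d ∸ 1) (apartInnerTerm (suc d))) (apartLastTerm n (suc d)) P i′ j′) ⟩
    coefLPS (apartTerm n (suc d)) P i′ j′ ∎
    where
    open ≡-Reasoning
    ks : List ℕ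
    ks = upTo (n ∸ suc d ∸ 1)
    tₗ : Tag
    tₗ = n ∸ suc d ∸ 1 , apart d , 0

  length-codes : 1 ≤ n → + length codes ≡ rhsCoef n i j
  length-codes 1≤n = begin
    + length codes
      ≡⟨ length-concatMap leaf (tags n) ⟩
    sumℤ (map (λ t → + length (leaf t)) (tags n))
      ≡⟨ cong sumℤ (Listₚ.map-cong (λ t → cong +_ (Listₚ.length-map (t ,_) (candidates t))) (tags n)) ⟩
    sumℤ (map count (tags n))
      ≡⟨ cong sumℤ (Listₚ.map-++ count (concatMap (adjacentTags n) ks) _) ⟩
    sumℤ (map count (concatMap (adjacentTags n) ks) ++ map count rest)
      ≡⟨ sumℤ-++ (map count (concatMap (adjacentTags n) ks)) _ ⟩
    sumℤ (map count (concatMap (adjacentTags n) ks)) +ℤ sumℤ (map count rest)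
      ≡⟨ cong₂ _+ℤ_ adjacent-part
           (cong₂ _+ℤ_ (lastʸ-term 1≤n) (cong₂ _+ℤ_ (lastˣ-term 1≤n) apart-part)) ⟩
    coefLPS (ΣLP (n ∸ 1) adjacentTerm) P i′ j′
      +ℤ (coefLPS lastʸTerm P i′ j′ +ℤ (coefLPS (lastˣTerm n) P i′ j′ +ℤ coefLPS (ΣLP (n ∸ 1) (apartTerm n)) P i′ j′))
      ≡⟨ sym (coefLPS-bracket n P i′ j′) ⟩
    coefLPS (bracket n) P i′ j′
      ≡⟨ sym (coefLPS-shift (+ suc n) (+ topDegree n) (bracket n) P i j) ⟩
    rhsCoef n i j ∎
    where
    open ≡-Reasoning
    ks : List ℕ
    ks = upTo (n ∸ 1)
    rest : List Tag
    rest = (n ∸ 1 , adjacentʸ , 0) ∷ (n ∸ 1 , adjacentˣ , 0) ∷ concatMap (apartTags n) ks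
    adjacent-part : sumℤ (map count (concatMap (adjacentTags n) ks)) ≡ coefLPS (ΣLP (n ∸ 1) adjacentTerm) P i′ j′
    adjacent-part = trans (sumℤ-map-concatMap count (adjacentTags n) ks)
      (trans (sumℤ-map-cong-∈ ks (λ k∈ → adjacent-term 1≤n _ (∈-upTo⁻ k∈))) (sym (coefLPS-ΣLP (n ∸ 1) adjacentTerm P i′ j′)))
    apart-part : sumℤ (map count (concatMap (apartTags n) ks)) ≡ coefLPS (ΣLP (n ∸ 1) (apartTerm n)) P i′ j′
    apart-part = trans (sumℤ-map-concatMap count (apartTags n) ks)
      (trans (sumℤ-map-cong-∈ ks (λ d∈ → apart-term _ (∈-upTo⁻ d∈))) (sym (coefLPS-ΣLP (n ∸ 1) (apartTerm n) P i′ j′)))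

  encodings : List (List ℕ)
  encodings = map encode codes

  encodings-unique : 1 ≤ n → Unique encodings
  encodings-unique 1≤n =
    unique-map-on (λ c∈ c′∈ → encode-injective _ _ (codes-wellFormed 1≤n c∈) (codes-wellFormed 1≤n c′∈)) codes-unique

  ∈-encodings : 1 ≤ n → ∀ {μ} → μ ∈ encodings ⇔ Counted μ
  ∈-encodings 1≤n {μ} = mk⇔ sound complete
    where
    sound : μ ∈ encodings → Counted μ
    sound μ∈ = subst Counted (sym (proj₂ (proj₂ c))) (encode-sound 1≤n (proj₁ (proj₂ c)))
      where
      c : ∃ λ c → c ∈ codes × μ ≡ encode c
      c = ∈-map⁻ encode μ∈
    complete : Counted μ → μ ∈ encodings
    complete counted = subst (_∈ encodings) (proj₂ (proj₂ c)) (∈-map⁺ encode (proj₁ (proj₂ c)))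
      where
      c : ∃ λ c → c ∈ codes × encode c ≡ μ
      c = encode-complete μ counted

  length-encodings : 1 ≤ n → + length encodings ≡ rhsCoef n i j
  length-encodings 1≤n = trans (cong +_ (Listₚ.length-map encode codes)) (length-codes 1≤n)


lemma3p4 : (n : ℕ) → 1 ≤ n → (i j : ℤ) →
    ∃ λ (L : List (List ℕ)) →
    Unique L ×
    (∀ (μ : List ℕ) → (μ ∈ L) ⇔ (In𝒜 μ × length μ ≡ 3 * n + 3 × Σ₁ μ ≡ i × + size μ ≡ j)) ×
    + length L ≡ rhsCoef n i j
lemma3p4 n 1≤n i j =
  encodings n i j , encodings-unique n i j 1≤n , (λ μ → ∈-encodings n i j 1≤n) , length-encodings n i j 1≤n
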